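{- Let $R=\mathbb{Z}[x_1,\ldots,x_N]$ and let $c_4,c_6,\Delta\in R$ be primitive polynomials satisfying $c_4^3-c_6^2=1728\Delta$. Suppose there exists $a_1\in R$ with $a_1^2c_4+c_6\equiv 0 \pmod 4$. Then there exist $a_2,a_3,a_4,a_6,b_2,b_4,b_6\in R$ such that $$b_2=a_1^2+4a_2,\quad b_4=a_1a_3+2a_4,\quad b_6=a_3^2+4a_6,\quad c_4=b_2^2-24b_4,\quad c_6=-b_2^3+36b_2b_4-216b_6.$$
   Context: A polynomial with integer coefficients is primitive if the gcd of its coefficients is $1$. Congruences modulo an integer are coefficientwise in $R$. -}

module Defs where

open import Data.Nat as ℕ using (ℕ)
open import Data.Nat.Divisibility as ℕD using ()
open import Data.Integer as ℤ using (ℤ; +_; ∣_∣)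
open import Data.Integer.Divisibility as ℤD using ()
open import Data.List using (List; []; _∷_; _++_; map; concatMap)
open import Data.Vec using (Vec; zipWith; replicate)
open import Data.Vec.Properties using (≡-dec)
open import Data.Product using (_×_; _,_)
open import Relation.Nullary using (yes; no)
open import Relation.Binary.PropositionalEquality using (_≡_)

-- Polynomials in ℤ[x₁,…,x_N], represented as finite lists of
-- (exponent vector, coefficient) terms; the polynomial is the sum of its terms.
Mono : ℕ → Set
Mono N = Vec ℕ N

Poly : ℕ → Set
Poly N = List (Mono N × ℤ)

coeff : ∀ {N} → Poly N → Mono N → ℤ
coeff [] m = + 0
coeff ((m′ , c) ∷ p) m with ≡-dec ℕ._≟_ m′ m
... | yes _ = c ℤ.+ coeff p m
... | no  _ = coeff p m

infix 4 _≈_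
_≈_ : ∀ {N} → Poly N → Poly N → Set
p ≈ q = ∀ m → coeff p m ≡ coeff q m

infixl 6 _⊕_ _⊖_
infixl 7 _⊗_ _·_

_⊕_ : ∀ {N} → Poly N → Poly N → Poly N
p ⊕ q = p ++ q

_·_ : ∀ {N} → ℤ → Poly N → Poly N
k · p = map (λ { (m , c) → (m , k ℤ.* c) }) p

⊝_ : ∀ {N} → Poly N → Poly N
⊝ p = ℤ.-[1+ 0 ] · p

_⊖_ : ∀ {N} → Poly N → Poly N → Poly N
p ⊖ q = p ⊕ (⊝ q)

_⊗_ : ∀ {N} → Poly N → Poly N → Poly N
p ⊗ q = concatMap (λ { (m , c) → map (λ { (m′ , c′) → (zipWith ℕ._+_ m m′ , c ℤ.* c′) }) q }) p

𝟘 : ∀ {N} → Poly N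
𝟘 = []

Primitive : ∀ {N} → Poly N → Set
Primitive p = ∀ (d : ℕ) → (∀ m → d ℕD.∣ ∣ coeff p m ∣) → d ≡ 1

infix 4 _≡_[mod_]
_≡_[mod_] : ∀ {N} → Poly N → Poly N → ℤ → Set
p ≡ q [mod n ] = ∀ m → n ℤD.∣ (coeff p m ℤ.- coeff q m)

-- Work in ℤ[x₁,…,x_N] modulo 2 and 3 with three tools for a prime p:
-- Gauss's lemma (p ∣ X Y and p ∤ Y imply p ∣ X, comparing lexicographically
-- largest coefficients not divisible by p), the Frobenius congruence
-- Pᵖ ≡ P(xᵖ) (mod p) for p = 2, 3, and its consequence that A(xᵖ) B ≡ C(xᵖ)
-- (mod p) with p ∤ A forces B ≡ s(xᵖ) (mod p).
--
-- Primitivity of c₆ gives 2, 3 ∤ c₆.  Modulo 3, c₄³ ≡ c₆² makes c₆ ≡ s³ and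
-- c₄ ≡ s² for some s; modulo 8, 4 ∣ a₁² c₄ + c₆ and the discriminant give
-- c₄ ≡ a₁⁴.  Put a₂ = −s − a₁² and b₂ = a₁² + 4 a₂: then b₂² ≡ c₄ modulo 8 and
-- modulo 3, which defines b₄, and h = −b₂³ + 36 b₂ b₄ − c₆ satisfies
-- h (h + 2 c₆) = 432 (b₄² (32 b₄ − b₂²) + 4 Δ), so 27 ∣ h (as 3 ∤ h + 2 c₆) and
-- 8 ∣ h (as 4 ∣ h and h/4 · (h/2 + c₆) is even with h/2 + c₆ odd): this
-- defines b₆.  Finally 4 Δ = b₂² (b₄² − b₂ b₆) − 32 b₄³ − 108 b₆² + 36 b₂ b₄ b₆
-- forces b₄² ≡ b₂ b₆ ≡ a₁² b₆ (mod 4), and Frobenius at p = 2 yields a₃ with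
-- b₆ ≡ a₃² (mod 2), after which a₄ and a₆ follow by Gauss's lemma.

module Submission where

open import Defs
open import Data.Nat as ℕ using (ℕ; zero; suc; s≤s)
import Data.Nat.Properties as ℕ
import Data.Nat.Divisibility as ℕ∣
import Data.Nat.DivMod as ℕ
open import Data.Nat.Primality using (Prime; prime?; prime[2]; euclidsLemma; prime⇒nonZero)
open import Data.Integer as ℤ using (ℤ; +_; -[1+_])
import Data.Integer.Properties as ℤ
import Data.Integer.DivMod as ℤ
import Data.Integer.Divisibility as ℤᵘ
open import Data.Integer.Divisibility.Signed as ℤ∣ using (divides; _∣?_)
open import Data.Integer.Tactic.RingSolver using (solve-∀)
open import Data.Vec as Vec using (Vec; []; _∷_; zipWith; replicate)
open import Data.Vec.Properties using (≡-dec)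
open import Data.Vec.Relation.Binary.Pointwise.Inductive as Pointwise using (Pointwise-≡⇒≡)
import Data.Vec.Relation.Unary.All as Vecᴬ
open import Data.List using (List; []; _∷_; _++_; map; concatMap; deduplicate; filter)
open import Data.List.Relation.Unary.Any using (here; there)
open import Data.List.Relation.Unary.All as All using (All; []; _∷_; all?)
import Data.List.Relation.Unary.All.Properties as All
open import Data.List.Relation.Unary.Unique.Propositional using (Unique)
import Data.List.Relation.Unary.AllPairs as AllPairs
import Data.List.Relation.Unary.Unique.DecPropositional.Properties as UniqueProperties
open import Data.List.Membership.Propositional using (_∈_; _∉_; find)
import Data.List.Membership.DecPropositional as DecMembership
open import Data.List.Membership.Propositional.Properties using (∈-deduplicate⁺)
open import Data.Product using (Σ; _×_; _,_; proj₁; proj₂; ∃)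
open import Data.Sum using (_⊎_; inj₁; inj₂; [_,_])
open import Data.Maybe using (nothing)
open import Data.Empty using (⊥-elim)
open import Function using (_∘_; _$_; case_of_)
open import Level using (0ℓ)
open import Relation.Nullary using (yes; no; ¬_; Dec; ¬?)
open import Relation.Nullary.Decidable using (toWitness; isYes; from-yes)
open import Relation.Unary using (Decidable)
open import Relation.Binary.PropositionalEquality hiding ([_])
open import Relation.Binary.Structures using (IsEquivalence)
open import Relation.Binary.Bundles using (Setoid)
open import Relation.Binary.Definitions using (tri<; tri≈; tri>)
import Relation.Binary.Reasoning.Setoid as SetoidReasoning
import Relation.Binary.Reflection as Reflection
open import Algebra.Bundles using (CommutativeRing)
open import Algebra.Structures using (IsCommutativeRing)
open import Algebra.Morphism.Structures using (module RingMorphisms)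
import Algebra.Properties.Semiring.Exp.TCOptimised as Exp
open import Tactic.RingSolver.Core.AlmostCommutativeRing using (AlmostCommutativeRing; fromCommutativeRing)
open import Tactic.RingSolver.Core.Polynomial.Parameters using (Homomorphism)
open import Tactic.RingSolver.Core.Expression
  using (Expr; Κ; Ι; module Eval) renaming (_⊕_ to _:+_; _⊗_ to _:*_; ⊝_ to :-_; _⊛_ to _:^_)
import Tactic.RingSolver.Core.Polynomial.Base as SparseHorner
import Tactic.RingSolver.Core.Polynomial.Semantics as SparseHornerSemantics
import Tactic.RingSolver.Core.Polynomial.Homomorphism as SparseHornerHomomorphism

∑ : {A : Set} → List A → (A → ℤ) → ℤ
∑ []       f = + 0
∑ (x ∷ xs) f = f x ℤ.+ ∑ xs f

module _ {A : Set} where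

  ∑-++ : ∀ (xs ys : List A) f → ∑ (xs ++ ys) f ≡ ∑ xs f ℤ.+ ∑ ys f
  ∑-++ []       ys f = sym (ℤ.+-identityˡ _)
  ∑-++ (x ∷ xs) ys f = trans (cong (ℤ._+_ (f x)) (∑-++ xs ys f)) (sym (ℤ.+-assoc (f x) _ _))

  ∑-cong : ∀ (xs : List A) {f g : A → ℤ} → (∀ x → f x ≡ g x) → ∑ xs f ≡ ∑ xs g
  ∑-cong []       f≗g = refl
  ∑-cong (x ∷ xs) f≗g = cong₂ ℤ._+_ (f≗g x) (∑-cong xs f≗g)

  ∑-zero : ∀ (xs : List A) → ∑ xs (λ _ → + 0) ≡ + 0
  ∑-zero []       = refl
  ∑-zero (x ∷ xs) = trans (ℤ.+-identityˡ _) (∑-zero xs)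

  ∑-+ : ∀ (xs : List A) f g → ∑ xs (λ x → f x ℤ.+ g x) ≡ ∑ xs f ℤ.+ ∑ xs g
  ∑-+ []       f g = refl
  ∑-+ (x ∷ xs) f g = trans (cong (ℤ._+_ (f x ℤ.+ g x)) (∑-+ xs f g)) (interchange (f x) (g x) _ _)
    where
    interchange : ∀ a b c d → a ℤ.+ b ℤ.+ (c ℤ.+ d) ≡ a ℤ.+ c ℤ.+ (b ℤ.+ d)
    interchange = solve-∀

  ∑-*ˡ : ∀ (xs : List A) k f → ∑ xs (λ x → k ℤ.* f x) ≡ k ℤ.* ∑ xs f
  ∑-*ˡ []       k f = sym (ℤ.*-zeroʳ k)
  ∑-*ˡ (x ∷ xs) k f = trans (cong (ℤ._+_ (k ℤ.* f x)) (∑-*ˡ xs k f)) (sym (ℤ.*-distribˡ-+ k (f x) _))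

  ∑-map : ∀ {B : Set} (g : B → A) (xs : List B) f → ∑ (map g xs) f ≡ ∑ xs (λ x → f (g x))
  ∑-map g []       f = refl
  ∑-map g (x ∷ xs) f = cong (ℤ._+_ (f (g x))) (∑-map g xs f)

  ∑-concatMap : ∀ {B : Set} (g : B → List A) (xs : List B) f →
                ∑ (concatMap g xs) f ≡ ∑ xs (λ x → ∑ (g x) f)
  ∑-concatMap g []       f = refl
  ∑-concatMap g (x ∷ xs) f =
    trans (∑-++ (g x) (concatMap g xs) f) (cong (ℤ._+_ (∑ (g x) f)) (∑-concatMap g xs f))


∑-comm : ∀ {A B : Set} (xs : List A) (ys : List B) (h : A → B → ℤ) →
         ∑ xs (λ x → ∑ ys (h x)) ≡ ∑ ys (λ y → ∑ xs (λ x → h x y))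
∑-comm []       ys h = sym (∑-zero ys)
∑-comm (x ∷ xs) ys h = trans (cong (ℤ._+_ (∑ ys (h x))) (∑-comm xs ys h))
                             (sym (∑-+ ys (h x) (λ y → ∑ xs (λ x′ → h x′ y))))

infixl 6 _+ᵛ_
_+ᵛ_ : ∀ {N} → Mono N → Mono N → Mono N
_+ᵛ_ = zipWith ℕ._+_

0ᵛ : ∀ {N} → Mono N
0ᵛ {N} = replicate N 0

+ᵛ-comm : ∀ {n} (a b : Mono n) → a +ᵛ b ≡ b +ᵛ a
+ᵛ-comm a b = Pointwise-≡⇒≡ (Pointwise.zipWith-comm ℕ.+-comm a b)

+ᵛ-assoc : ∀ {n} (a b c : Mono n) → a +ᵛ b +ᵛ c ≡ a +ᵛ (b +ᵛ c)
+ᵛ-assoc a b c = Pointwise-≡⇒≡ (Pointwise.zipWith-assoc ℕ.+-assoc a b c)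

+ᵛ-identityˡ : ∀ {n} (a : Mono n) → 0ᵛ +ᵛ a ≡ a
+ᵛ-identityˡ []      = refl
+ᵛ-identityˡ (x ∷ a) = cong (x ∷_) (+ᵛ-identityˡ a)

+ᵛ-∸ᵛ : ∀ {n} (a u : Mono n) → zipWith ℕ._∸_ (a +ᵛ u) a ≡ u
+ᵛ-∸ᵛ []      []      = refl
+ᵛ-∸ᵛ (x ∷ a) (y ∷ u) = cong₂ _∷_ (ℕ.m+n∸m≡n x y) (+ᵛ-∸ᵛ a u)

+ᵛ-cancelˡ : ∀ {n} (a b c : Mono n) → a +ᵛ b ≡ a +ᵛ c → b ≡ c
+ᵛ-cancelˡ a b c eq =
  trans (sym (+ᵛ-∸ᵛ a b)) (trans (cong (λ v → zipWith ℕ._∸_ v a) eq) (+ᵛ-∸ᵛ a c))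

-- xᵃ divides xᵐ iff a + (m ∸ a) = m
_∣ᵛ?_ : ∀ {n} (a m : Mono n) → Dec (∃ λ u → a +ᵛ u ≡ m)
a ∣ᵛ? m with ≡-dec ℕ._≟_ (a +ᵛ zipWith ℕ._∸_ m a) m
... | yes eq = yes (_ , eq)
... | no neq = no λ { (u , refl) → neq (cong (a +ᵛ_) (+ᵛ-∸ᵛ a u)) }

module _ {N : ℕ} where

  δ : Mono N → Mono N → ℤ → ℤ
  δ m′ m c with ≡-dec ℕ._≟_ m′ m
  ... | yes _ = c
  ... | no  _ = + 0

  δ-refl : ∀ m c → δ m m c ≡ c
  δ-refl m c with ≡-dec ℕ._≟_ m m
  ... | yes _  = refl
  ... | no m≢m = ⊥-elim (m≢m refl)

  δ-≢ : ∀ {m′ m} c → m′ ≢ m → δ m′ m c ≡ + 0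
  δ-≢ {m′} {m} c m′≢m with ≡-dec ℕ._≟_ m′ m
  ... | yes eq = ⊥-elim (m′≢m eq)
  ... | no  _  = refl

  δ-zero : ∀ m′ m → δ m′ m (+ 0) ≡ + 0
  δ-zero m′ m with ≡-dec ℕ._≟_ m′ m
  ... | yes _ = refl
  ... | no  _ = refl

  δ-cong : ∀ {a b c d} x → (a ≡ b → c ≡ d) → (c ≡ d → a ≡ b) → δ a b x ≡ δ c d x
  δ-cong {a} {b} {c} {d} x to from with ≡-dec ℕ._≟_ a b | ≡-dec ℕ._≟_ c d
  ... | yes _  | yes _  = refl
  ... | no  _  | no  _  = refl
  ... | yes eq | no neq = ⊥-elim (neq (to eq))
  ... | no neq | yes eq = ⊥-elim (neq (from eq))

  δ-*ˡ : ∀ m′ m k c → δ m′ m (k ℤ.* c) ≡ k ℤ.* δ m′ m c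
  δ-*ˡ m′ m k c with ≡-dec ℕ._≟_ m′ m
  ... | yes _ = refl
  ... | no  _ = sym (ℤ.*-zeroʳ k)

  δ-+ : ∀ m′ m a b → δ m′ m (a ℤ.+ b) ≡ δ m′ m a ℤ.+ δ m′ m b
  δ-+ m′ m a b with ≡-dec ℕ._≟_ m′ m
  ... | yes _ = refl
  ... | no  _ = refl

  δ-neg : ∀ m′ m c → δ m′ m (ℤ.- c) ≡ ℤ.- δ m′ m c
  δ-neg m′ m c with ≡-dec ℕ._≟_ m′ m
  ... | yes _ = refl
  ... | no  _ = refl

  coeff-∷ : ∀ (m′ : Mono N) c p m → coeff ((m′ , c) ∷ p) m ≡ δ m′ m c ℤ.+ coeff p m
  coeff-∷ m′ c p m with ≡-dec ℕ._≟_ m′ m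
  ... | yes _ = refl
  ... | no  _ = sym (ℤ.+-identityˡ _)

  termAt : Mono N → Mono N × ℤ → ℤ
  termAt m (m′ , c) = δ m′ m c

  coeff≡∑ : ∀ (p : Poly N) m → coeff p m ≡ ∑ p (termAt m)
  coeff≡∑ []             m = refl
  coeff≡∑ ((m′ , c) ∷ p) m = trans (coeff-∷ m′ c p m) (cong (ℤ._+_ (δ m′ m c)) (coeff≡∑ p m))

  coeff-⊕ : ∀ (p q : Poly N) m → coeff (p ⊕ q) m ≡ coeff p m ℤ.+ coeff q m
  coeff-⊕ p q m = begin
    coeff (p ++ q) m                       ≡⟨ coeff≡∑ (p ++ q) m ⟩
    ∑ (p ++ q) (termAt m)                  ≡⟨ ∑-++ p q (termAt m) ⟩
    ∑ p (termAt m) ℤ.+ ∑ q (termAt m)      ≡⟨ sym (cong₂ ℤ._+_ (coeff≡∑ p m) (coeff≡∑ q m)) ⟩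
    coeff p m ℤ.+ coeff q m                ∎
    where open ≡-Reasoning

  coeff-· : ∀ k (p : Poly N) m → coeff (k · p) m ≡ k ℤ.* coeff p m
  coeff-· k p m = begin
    coeff (k · p) m                         ≡⟨ coeff≡∑ (k · p) m ⟩
    ∑ (k · p) (termAt m)                    ≡⟨ ∑-map _ p (termAt m) ⟩
    ∑ p (λ t → δ (proj₁ t) m (k ℤ.* proj₂ t)) ≡⟨ ∑-cong p (λ t → δ-*ˡ (proj₁ t) m k (proj₂ t)) ⟩
    ∑ p (λ t → k ℤ.* termAt m t)            ≡⟨ ∑-*ˡ p k (termAt m) ⟩
    k ℤ.* ∑ p (termAt m)                    ≡⟨ cong (ℤ._*_ k) (sym (coeff≡∑ p m)) ⟩
    k ℤ.* coeff p m                         ∎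
    where open ≡-Reasoning

  coeff-⊝ : ∀ (p : Poly N) m → coeff (⊝ p) m ≡ ℤ.- coeff p m
  coeff-⊝ p m = trans (coeff-· -[1+ 0 ] p m) (ℤ.-1*i≡-i (coeff p m))

  ∑-⊗ : ∀ (p q : Poly N) F →
        ∑ (p ⊗ q) F ≡ ∑ p (λ s → ∑ q (λ t → F (proj₁ s +ᵛ proj₁ t , proj₂ s ℤ.* proj₂ t)))
  ∑-⊗ p q F = trans (∑-concatMap _ p F) (∑-cong p (λ s → ∑-map _ q F))

  coeff-⊗ : ∀ (p q : Poly N) m →
            coeff (p ⊗ q) m ≡ ∑ p (λ s → ∑ q (λ t → δ (proj₁ s +ᵛ proj₁ t) m (proj₂ s ℤ.* proj₂ t)))
  coeff-⊗ p q m = trans (coeff≡∑ (p ⊗ q) m) (∑-⊗ p q (termAt m))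

  shiftedCoeff : Poly N → Mono N → Mono N → ℤ
  shiftedCoeff q a m = ∑ q (λ t → δ (a +ᵛ proj₁ t) m (proj₂ t))

  coeff-⊗′ : ∀ (p q : Poly N) m → coeff (p ⊗ q) m ≡ ∑ p (λ s → proj₂ s ℤ.* shiftedCoeff q (proj₁ s) m)
  coeff-⊗′ p q m = trans (coeff-⊗ p q m) (∑-cong p (λ s →
    trans (∑-cong q (λ t → δ-*ˡ _ m (proj₂ s) (proj₂ t))) (∑-*ˡ q (proj₂ s) _)))

  shiftedCoeff-∣ : ∀ (q : Poly N) a m u → a +ᵛ u ≡ m → shiftedCoeff q a m ≡ coeff q u
  shiftedCoeff-∣ q a m u a+u≡m = trans
    (∑-cong q (λ t → δ-cong (proj₂ t) (λ eq → +ᵛ-cancelˡ a _ _ (trans eq (sym a+u≡m)))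
                                       (λ eq → trans (cong (a +ᵛ_) eq) a+u≡m)))
    (sym (coeff≡∑ q u))

  shiftedCoeff-∤ : ∀ (q : Poly N) a m → ¬ (∃ λ u → a +ᵛ u ≡ m) → shiftedCoeff q a m ≡ + 0
  shiftedCoeff-∤ q a m a∤m = trans (∑-cong q (λ t → δ-≢ (proj₂ t) (λ eq → a∤m (_ , eq)))) (∑-zero q)

  shiftedCoeff-cong : ∀ {q q′ : Poly N} → q ≈ q′ → ∀ a m → shiftedCoeff q a m ≡ shiftedCoeff q′ a m
  shiftedCoeff-cong {q} {q′} q≈q′ a m with a ∣ᵛ? m
  ... | yes (u , eq) = trans (shiftedCoeff-∣ q a m u eq) (trans (q≈q′ u) (sym (shiftedCoeff-∣ q′ a m u eq)))
  ... | no  a∤m     = trans (shiftedCoeff-∤ q a m a∤m) (sym (shiftedCoeff-∤ q′ a m a∤m))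

κ : ∀ {N} → ℤ → Poly N
κ k = (0ᵛ , k) ∷ []

module _ {N : ℕ} where

  coeff-κ⊗ : ∀ k (p : Poly N) m → coeff (κ k ⊗ p) m ≡ k ℤ.* coeff p m
  coeff-κ⊗ k p m = trans (coeff-⊗′ (κ k) p m) (trans (ℤ.+-identityʳ _) (cong (ℤ._*_ k)
    (trans (∑-cong p (λ t → cong (λ v → δ v m (proj₂ t)) (+ᵛ-identityˡ (proj₁ t)))) (sym (coeff≡∑ p m)))))

  coeff-κ : ∀ k m → coeff (κ {N} k) m ≡ δ 0ᵛ m k
  coeff-κ k m = trans (coeff-∷ 0ᵛ k [] m) (ℤ.+-identityʳ _)


-- The ring of polynomials

-- Coefficientwise equality _≈_ wrapped in a record, so that Agda can infer
-- the polynomials it relates (coeff is not injective).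
infix 4 _≋_
record _≋_ {N} (p q : Poly N) : Set where
  constructor coeffwise
  field ≋⇒≈ : p ≈ q
open _≋_ public

module _ {N : ℕ} where

  ≋-refl : {p : Poly N} → p ≋ p
  ≋-refl = coeffwise λ m → refl

  ≋-sym : {p q : Poly N} → p ≋ q → q ≋ p
  ≋-sym (coeffwise p≈q) = coeffwise λ m → sym (p≈q m)

  ≋-trans : {p q r : Poly N} → p ≋ q → q ≋ r → p ≋ r
  ≋-trans (coeffwise p≈q) (coeffwise q≈r) = coeffwise λ m → trans (p≈q m) (q≈r m)

  ≋-isEquivalence : IsEquivalence (_≋_ {N})
  ≋-isEquivalence = record { refl = ≋-refl ; sym = ≋-sym ; trans = ≋-trans }

≋-setoid : ℕ → Setoid 0ℓ 0ℓ
≋-setoid N = record { isEquivalence = ≋-isEquivalence {N} }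

module ≋-Reasoning {N : ℕ} = SetoidReasoning (≋-setoid N)

module _ {N : ℕ} where

  ⊕-cong : ∀ {p p′ q q′ : Poly N} → p ≋ p′ → q ≋ q′ → p ⊕ q ≋ p′ ⊕ q′
  ⊕-cong {p} {p′} {q} {q′} (coeffwise p≈p′) (coeffwise q≈q′) = coeffwise λ m →
    trans (coeff-⊕ p q m) (trans (cong₂ ℤ._+_ (p≈p′ m) (q≈q′ m)) (sym (coeff-⊕ p′ q′ m)))

  ⊝-cong : ∀ {p p′ : Poly N} → p ≋ p′ → ⊝ p ≋ ⊝ p′
  ⊝-cong {p} {p′} (coeffwise p≈p′) = coeffwise λ m →
    trans (coeff-⊝ p m) (trans (cong ℤ.-_ (p≈p′ m)) (sym (coeff-⊝ p′ m)))

  ⊗-congˡ : ∀ (p : Poly N) {q q′} → q ≋ q′ → p ⊗ q ≋ p ⊗ q′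
  ⊗-congˡ p {q} {q′} (coeffwise q≈q′) = coeffwise λ m → trans (coeff-⊗′ p q m) (trans
    (∑-cong p (λ s → cong (ℤ._*_ (proj₂ s)) (shiftedCoeff-cong {q = q} {q′} q≈q′ (proj₁ s) m)))
    (sym (coeff-⊗′ p q′ m)))

  ⊕-assoc : ∀ (p q r : Poly N) → p ⊕ q ⊕ r ≋ p ⊕ (q ⊕ r)
  ⊕-assoc p q r = coeffwise λ m → begin
    coeff (p ⊕ q ⊕ r) m                          ≡⟨ coeff-⊕ (p ⊕ q) r m ⟩
    coeff (p ⊕ q) m ℤ.+ coeff r m                ≡⟨ cong (ℤ._+ coeff r m) (coeff-⊕ p q m) ⟩
    coeff p m ℤ.+ coeff q m ℤ.+ coeff r m        ≡⟨ ℤ.+-assoc (coeff p m) (coeff q m) (coeff r m) ⟩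
    coeff p m ℤ.+ (coeff q m ℤ.+ coeff r m)      ≡⟨ cong (ℤ._+_ (coeff p m)) (sym (coeff-⊕ q r m)) ⟩
    coeff p m ℤ.+ coeff (q ⊕ r) m                ≡⟨ sym (coeff-⊕ p (q ⊕ r) m) ⟩
    coeff (p ⊕ (q ⊕ r)) m                        ∎
    where open ≡-Reasoning

  ⊕-comm : ∀ (p q : Poly N) → p ⊕ q ≋ q ⊕ p
  ⊕-comm p q = coeffwise λ m → trans (coeff-⊕ p q m) (trans (ℤ.+-comm (coeff p m) _) (sym (coeff-⊕ q p m)))

  ⊕-identityʳ : ∀ (p : Poly N) → p ⊕ 𝟘 ≋ p
  ⊕-identityʳ p = coeffwise λ m → trans (coeff-⊕ p 𝟘 m) (ℤ.+-identityʳ _)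

  ⊝-inverseʳ : ∀ (p : Poly N) → p ⊖ p ≋ 𝟘
  ⊝-inverseʳ p = coeffwise λ m →
    trans (coeff-⊕ p (⊝ p) m) (trans (cong (ℤ._+_ (coeff p m)) (coeff-⊝ p m)) (ℤ.+-inverseʳ (coeff p m)))

  ⊝-inverseˡ : ∀ (p : Poly N) → ⊝ p ⊕ p ≋ 𝟘
  ⊝-inverseˡ p = ≋-trans (⊕-comm (⊝ p) p) (⊝-inverseʳ p)

  ⊗-comm : ∀ (p q : Poly N) → p ⊗ q ≋ q ⊗ p
  ⊗-comm p q = coeffwise λ m → begin
    coeff (p ⊗ q) m                                                        ≡⟨ coeff-⊗ p q m ⟩
    ∑ p (λ s → ∑ q (λ t → δ (proj₁ s +ᵛ proj₁ t) m (proj₂ s ℤ.* proj₂ t))) ≡⟨ ∑-comm p q _ ⟩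
    ∑ q (λ t → ∑ p (λ s → δ (proj₁ s +ᵛ proj₁ t) m (proj₂ s ℤ.* proj₂ t))) ≡⟨ ∑-cong q (λ t → ∑-cong p (λ s →
                                                     cong₂ (λ v c → δ v m c) (+ᵛ-comm (proj₁ s) (proj₁ t))
                                                                            (ℤ.*-comm (proj₂ s) (proj₂ t)))) ⟩
    ∑ q (λ t → ∑ p (λ s → δ (proj₁ t +ᵛ proj₁ s) m (proj₂ t ℤ.* proj₂ s))) ≡⟨ sym (coeff-⊗ q p m) ⟩
    coeff (q ⊗ p) m                                                        ∎
    where open ≡-Reasoning

  ⊗-cong : ∀ {p p′ q q′ : Poly N} → p ≋ p′ → q ≋ q′ → p ⊗ q ≋ p′ ⊗ q′
  ⊗-cong {p} {p′} {q} {q′} p≋p′ q≋q′ =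
    ≋-trans (⊗-congˡ p q≋q′) (≋-trans (⊗-comm p q′) (≋-trans (⊗-congˡ q′ p≋p′) (⊗-comm q′ p′)))

  ⊗-assoc : ∀ (p q r : Poly N) → p ⊗ q ⊗ r ≋ p ⊗ (q ⊗ r)
  ⊗-assoc p q r = coeffwise λ m → begin
    coeff (p ⊗ q ⊗ r) m
      ≡⟨ trans (coeff-⊗ (p ⊗ q) r m) (∑-⊗ p q _) ⟩
    ∑ p (λ s → ∑ q (λ t → ∑ r (λ u → δ (proj₁ s +ᵛ proj₁ t +ᵛ proj₁ u) m (proj₂ s ℤ.* proj₂ t ℤ.* proj₂ u))))
      ≡⟨ ∑-cong p (λ s → ∑-cong q (λ t → ∑-cong r (λ u →
           cong₂ (λ v c → δ v m c) (+ᵛ-assoc (proj₁ s) (proj₁ t) (proj₁ u)) (ℤ.*-assoc (proj₂ s) (proj₂ t) (proj₂ u))))) ⟩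
    ∑ p (λ s → ∑ q (λ t → ∑ r (λ u → δ (proj₁ s +ᵛ (proj₁ t +ᵛ proj₁ u)) m (proj₂ s ℤ.* (proj₂ t ℤ.* proj₂ u)))))
      ≡⟨ sym (trans (coeff-⊗ p (q ⊗ r) m) (∑-cong p (λ s → ∑-⊗ q r _))) ⟩
    coeff (p ⊗ (q ⊗ r)) m ∎
    where open ≡-Reasoning

  ⊗-distribˡ-⊕ : ∀ (p q r : Poly N) → p ⊗ (q ⊕ r) ≋ p ⊗ q ⊕ p ⊗ r
  ⊗-distribˡ-⊕ p q r = coeffwise λ m → trans (coeff-⊗ p (q ⊕ r) m) (trans (∑-cong p (λ s → ∑-++ q r _))
    (trans (∑-+ p _ _) (sym (trans (coeff-⊕ (p ⊗ q) (p ⊗ r) m) (cong₂ ℤ._+_ (coeff-⊗ p q m) (coeff-⊗ p r m))))))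

  ⊗-distribʳ-⊕ : ∀ (p q r : Poly N) → (q ⊕ r) ⊗ p ≋ q ⊗ p ⊕ r ⊗ p
  ⊗-distribʳ-⊕ p q r = coeffwise λ m → trans (coeff-⊗ (q ⊕ r) p m) (trans (∑-++ q r _)
    (sym (trans (coeff-⊕ (q ⊗ p) (r ⊗ p) m) (cong₂ ℤ._+_ (coeff-⊗ q p m) (coeff-⊗ r p m)))))

  ⊗-identityˡ : ∀ (p : Poly N) → κ (+ 1) ⊗ p ≋ p
  ⊗-identityˡ p = coeffwise λ m → trans (coeff-κ⊗ (+ 1) p m) (ℤ.*-identityˡ _)

  ⊗-identityʳ : ∀ (p : Poly N) → p ⊗ κ (+ 1) ≋ p
  ⊗-identityʳ p = ≋-trans (⊗-comm p (κ (+ 1))) (⊗-identityˡ p)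

  ⊗-isCommutativeRing : IsCommutativeRing (_≋_ {N}) _⊕_ _⊗_ ⊝_ 𝟘 (κ (+ 1))
  ⊗-isCommutativeRing = record
    { isRing = record
      { +-isAbelianGroup = record
        { isGroup = record
          { isMonoid = record
            { isSemigroup = record
              { isMagma = record { isEquivalence = ≋-isEquivalence ; ∙-cong = ⊕-cong }
              ; assoc   = ⊕-assoc }
            ; identity = (λ p → ≋-refl) , ⊕-identityʳ }
          ; inverse = ⊝-inverseˡ , ⊝-inverseʳ
          ; ⁻¹-cong = ⊝-cong }
        ; comm = ⊕-comm }
      ; *-cong     = ⊗-cong
      ; *-assoc    = ⊗-assoc
      ; *-identity = ⊗-identityˡ , ⊗-identityʳ
      ; distrib    = ⊗-distribˡ-⊕ , λ p q r → ⊗-distribʳ-⊕ p q r }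
    ; *-comm = ⊗-comm }

  κ-+ : ∀ a b → κ {N} (a ℤ.+ b) ≋ κ a ⊕ κ b
  κ-+ a b = coeffwise λ m → trans (coeff-κ _ m) (trans (δ-+ 0ᵛ m a b)
    (sym (trans (coeff-⊕ (κ a) (κ b) m) (cong₂ ℤ._+_ (coeff-κ a m) (coeff-κ b m)))))

  κ-* : ∀ a b → κ {N} (a ℤ.* b) ≋ κ a ⊗ κ b
  κ-* a b = coeffwise λ m → trans (coeff-κ _ m) (trans (δ-*ˡ 0ᵛ m a b)
    (sym (trans (coeff-κ⊗ a (κ b) m) (cong (ℤ._*_ a) (coeff-κ b m)))))

  κ-neg : ∀ a → κ {N} (ℤ.- a) ≋ ⊝ κ a
  κ-neg a = coeffwise λ m →
    trans (coeff-κ _ m) (trans (δ-neg 0ᵛ m a) (sym (trans (coeff-⊝ (κ a) m) (cong ℤ.-_ (coeff-κ a m)))))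

  κ-0 : κ {N} (+ 0) ≋ 𝟘
  κ-0 = coeffwise λ m → trans (coeff-κ _ m) (δ-zero 0ᵛ m)

  ·≋κ⊗ : ∀ k (p : Poly N) → k · p ≋ κ k ⊗ p
  ·≋κ⊗ k p = coeffwise λ m → trans (coeff-· k p m) (sym (coeff-κ⊗ k p m))

-- Tactic.RingSolver.NonReflective takes its constants from R itself; here they
-- are integers mapped into R by ι, so identities with numerals normalise.
module ℤ-AlgebraSolver
  (R : CommutativeRing 0ℓ 0ℓ)
  (ι : ℤ → CommutativeRing.Carrier R)
  (ι-isRingHomomorphism : RingMorphisms.IsRingHomomorphism ℤ.+-*-rawRing (CommutativeRing.rawRing R) ι)
  where

  private
    module R = CommutativeRing R
    open RingMorphisms.IsRingHomomorphism ι-isRingHomomorphism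

    R′ : AlmostCommutativeRing 0ℓ 0ℓ
    R′ = fromCommutativeRing R (λ _ → nothing)

    homomorphism : Homomorphism 0ℓ 0ℓ 0ℓ 0ℓ
    homomorphism = record
      { from = record { rawRing = ℤ.+-*-rawRing ; isZero = λ x → isYes (x ℤ.≟ + 0) }
      ; to = R′
      ; morphism = record
        { ⟦_⟧ = ι ; +-homo = +-homo ; *-homo = *-homo ; -‿homo = -‿homo ; 0-homo = 0#-homo ; 1-homo = 1#-homo }
      ; Zero-C⟶Zero-R = λ x x≟0 → R.trans (R.sym 0#-homo) (⟦⟧-cong (sym (toWitness x≟0)))
      }

    open Eval (AlmostCommutativeRing.rawRing R′) ι
    open SparseHorner (Homomorphism.from homomorphism) using (_⊞_; _⊠_; ⊟_; _⊡_)
      renaming (Poly to Horner; κ to constant; ι to var)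
    open SparseHornerSemantics homomorphism renaming (⟦_⟧ to ⟦_⟧ₕ)
    open SparseHornerHomomorphism homomorphism
    open Exp (AlmostCommutativeRing.semiring R′) using (^-congˡ)

    normalise : ∀ {n} → Expr ℤ n → Horner n
    normalise (Κ x)    = constant x
    normalise (Ι x)    = var x
    normalise (x :+ y) = normalise x ⊞ normalise y
    normalise (x :* y) = normalise x ⊠ normalise y
    normalise (:- x)   = ⊟ normalise x
    normalise (x :^ i) = normalise x ⊡ i

    ⟦_⇓⟧ : ∀ {n} → Expr ℤ n → Vec R.Carrier n → R.Carrier
    ⟦ e ⇓⟧ = ⟦ normalise e ⟧ₕ

    correct : ∀ {n} (e : Expr ℤ n) ρ → ⟦ e ⇓⟧ ρ R.≈ ⟦ e ⟧ ρ
    correct (Κ x)    ρ = κ-hom x ρ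
    correct (Ι x)    ρ = ι-hom x ρ
    correct (x :+ y) ρ = R.trans (⊞-hom (normalise x) (normalise y) ρ) (R.+-cong (correct x ρ) (correct y ρ))
    correct (x :* y) ρ = R.trans (⊠-hom (normalise x) (normalise y) ρ) (R.*-cong (correct x ρ) (correct y ρ))
    correct (:- x)   ρ = R.trans (⊟-hom (normalise x) ρ) (R.-‿cong (correct x ρ))
    correct (x :^ i) ρ = R.trans (⊡-hom (normalise x) i ρ) (^-congˡ i (correct x ρ))

  open Reflection R.setoid Ι ⟦_⟧ ⟦_⇓⟧ correct public using (solve; _⊜_)

⊗-commutativeRing : ℕ → CommutativeRing 0ℓ 0ℓ
⊗-commutativeRing N = record { isCommutativeRing = ⊗-isCommutativeRing {N} }

κ-isRingHomomorphism : ∀ N → RingMorphisms.IsRingHomomorphism ℤ.+-*-rawRing (CommutativeRing.rawRing (⊗-commutativeRing N)) κ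
κ-isRingHomomorphism N = record
  { isSemiringHomomorphism = record
    { isNearSemiringHomomorphism = record
      { +-isMonoidHomomorphism = record
        { isMagmaHomomorphism = record
          { isRelHomomorphism = record { cong = λ { refl → ≋-refl } }
          ; homo = κ-+ }
        ; ε-homo = κ-0 }
      ; *-homo = κ-* }
    ; 1#-homo = ≋-refl }
  ; -‿homo = κ-neg }

module PolynomialSolver (N : ℕ) = ℤ-AlgebraSolver (⊗-commutativeRing N) κ (κ-isRingHomomorphism N)

infixl 6 _:-_
_:-_ : ∀ {n} → Expr ℤ n → Expr ℤ n → Expr ℤ n
x :- y = x :+ (:- y)

#_ : ∀ {n} → ℕ → Expr ℤ n
# k = Κ (+ k)

module _ {N : ℕ} where

  ⊖-≋𝟘⇒≋ : ∀ {A B : Poly N} → A ⊖ B ≋ 𝟘 → A ≋ B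
  ⊖-≋𝟘⇒≋ {A} {B} (coeffwise A-B≈0) = coeffwise λ m → ℤ.i-j≡0⇒i≡j (coeff A m) (coeff B m)
    (trans (sym (trans (coeff-⊕ A (⊝ B) m) (cong (ℤ._+_ (coeff A m)) (coeff-⊝ B m)))) (A-B≈0 m))

  ≋⇒⊖-≋𝟘 : ∀ {A B : Poly N} → A ≋ B → A ⊖ B ≋ 𝟘
  ≋⇒⊖-≋𝟘 {A} {B} A≋B = ≋-trans (⊕-cong A≋B ≋-refl) (⊝-inverseʳ B)

  ⊗-≋𝟘 : ∀ (Q : Poly N) {Z} → Z ≋ 𝟘 → Q ⊗ Z ≋ 𝟘
  ⊗-≋𝟘 Q Z≋0 = ≋-trans (⊗-congˡ Q Z≋0) (coeffwise λ m → trans (coeff-⊗ Q 𝟘 m) (∑-zero Q))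

  ⊕-≋𝟘 : ∀ {Y Z : Poly N} → Y ≋ 𝟘 → Z ≋ 𝟘 → Y ⊕ Z ≋ 𝟘
  ⊕-≋𝟘 Y≋0 Z≋0 = ≋-trans (⊕-cong Y≋0 Z≋0) (⊕-identityʳ 𝟘)

  combine₁ : ∀ {L R A B : Poly N} (Q : Poly N) → A ≋ B → L ⊖ R ≋ Q ⊗ (A ⊖ B) → L ≋ R
  combine₁ Q A≋B identity = ⊖-≋𝟘⇒≋ (≋-trans identity (⊗-≋𝟘 Q (≋⇒⊖-≋𝟘 A≋B)))

  combine₂ : ∀ {L R A₁ B₁ A₂ B₂ : Poly N} (Q₁ Q₂ : Poly N) → A₁ ≋ B₁ → A₂ ≋ B₂ →
             L ⊖ R ≋ Q₁ ⊗ (A₁ ⊖ B₁) ⊕ Q₂ ⊗ (A₂ ⊖ B₂) → L ≋ R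
  combine₂ Q₁ Q₂ A₁≋B₁ A₂≋B₂ identity = ⊖-≋𝟘⇒≋ (≋-trans identity
    (⊕-≋𝟘 (⊗-≋𝟘 Q₁ (≋⇒⊖-≋𝟘 A₁≋B₁)) (⊗-≋𝟘 Q₂ (≋⇒⊖-≋𝟘 A₂≋B₂))))

  combine₃ : ∀ {L R A₁ B₁ A₂ B₂ A₃ B₃ : Poly N} (Q₁ Q₂ Q₃ : Poly N) → A₁ ≋ B₁ → A₂ ≋ B₂ → A₃ ≋ B₃ →
             L ⊖ R ≋ Q₁ ⊗ (A₁ ⊖ B₁) ⊕ Q₂ ⊗ (A₂ ⊖ B₂) ⊕ Q₃ ⊗ (A₃ ⊖ B₃) → L ≋ R
  combine₃ Q₁ Q₂ Q₃ A₁≋B₁ A₂≋B₂ A₃≋B₃ identity = ⊖-≋𝟘⇒≋ (≋-trans identity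
    (⊕-≋𝟘 (⊕-≋𝟘 (⊗-≋𝟘 Q₁ (≋⇒⊖-≋𝟘 A₁≋B₁)) (⊗-≋𝟘 Q₂ (≋⇒⊖-≋𝟘 A₂≋B₂))) (⊗-≋𝟘 Q₃ (≋⇒⊖-≋𝟘 A₃≋B₃))))

module _ {N : ℕ} where
  open PolynomialSolver N

  ⊖≋⇒≋⊕ : ∀ {A B C : Poly N} → A ⊖ B ≋ C → A ≋ B ⊕ C
  ⊖≋⇒≋⊕ {A} {B} {C} A-B≋C = combine₁ (κ (+ 1)) A-B≋C
    (solve 3 (λ A B C → A :- (B :+ C) ⊜ # 1 :* (A :- B :- C)) ≋-refl A B C)

  ⊖≋⇒≋⊖ : ∀ {A B C : Poly N} → A ⊖ B ≋ C → B ≋ A ⊖ C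
  ⊖≋⇒≋⊖ {A} {B} {C} A-B≋C = combine₁ (κ -[1+ 0 ]) A-B≋C
    (solve 3 (λ A B C → B :- (A :- C) ⊜ Κ -[1+ 0 ] :* (A :- B :- C)) ≋-refl A B C)

module _ {N : ℕ} where

  private
    _≟ᵛ_ : (a b : Mono N) → Dec (a ≡ b)
    _≟ᵛ_ = ≡-dec ℕ._≟_
    open DecMembership _≟ᵛ_ using (_∈?_)
    open UniqueProperties _≟ᵛ_ using (deduplicate-!)

  support : Poly N → List (Mono N)
  support p = deduplicate _≟ᵛ_ (map proj₁ p)

  coeff-∉ : ∀ (p : Poly N) {m} → m ∉ map proj₁ p → coeff p m ≡ + 0
  coeff-∉ []             m∉ = refl
  coeff-∉ ((m′ , c) ∷ p) {m} m∉ = trans (coeff-∷ m′ c p m)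
    (cong₂ ℤ._+_ (δ-≢ c (λ m′≡m → m∉ (here (sym m′≡m)))) (coeff-∉ p (m∉ ∘ there)))

  coeff-∉-support : ∀ (p : Poly N) {m} → m ∉ support p → coeff p m ≡ + 0
  coeff-∉-support p m∉ = coeff-∉ p (m∉ ∘ ∈-deduplicate⁺ _≟ᵛ_)

  tabulateOn : List (Mono N) → (Mono N → ℤ) → Poly N
  tabulateOn S f = map (λ m → (m , f m)) S

  coeff-tabulateOn-∉ : ∀ S f {m₀} → m₀ ∉ S → coeff (tabulateOn S f) m₀ ≡ + 0
  coeff-tabulateOn-∉ []      f m₀∉ = refl
  coeff-tabulateOn-∉ (m ∷ S) f m₀∉ = trans (coeff-∷ m (f m) _ _)
    (cong₂ ℤ._+_ (δ-≢ (f m) (λ m≡m₀ → m₀∉ (here (sym m≡m₀)))) (coeff-tabulateOn-∉ S f (m₀∉ ∘ there)))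

  coeff-tabulateOn-∈ : ∀ S f {m₀} → Unique S → m₀ ∈ S → coeff (tabulateOn S f) m₀ ≡ f m₀
  coeff-tabulateOn-∈ (m ∷ S) f (m∉S AllPairs.∷ _) (here refl) = trans (coeff-∷ m (f m) _ _)
    (trans (cong₂ ℤ._+_ (δ-refl m (f m)) (coeff-tabulateOn-∉ S f (λ m∈S → All.lookup m∉S m∈S refl)))
           (ℤ.+-identityʳ _))
  coeff-tabulateOn-∈ (m ∷ S) f (m∉S AllPairs.∷ S!) (there m₀∈S) = trans (coeff-∷ m (f m) _ _)
    (trans (cong₂ ℤ._+_ (δ-≢ (f m) (All.lookup m∉S m₀∈S)) (coeff-tabulateOn-∈ S f S! m₀∈S))
           (ℤ.+-identityˡ _))

  tabulateOn-support : ∀ (p : Poly N) f → (∀ m → m ∈ support p → coeff p m ≡ f m) → p ≋ tabulateOn (support p) f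
  tabulateOn-support p f agree = coeffwise agreeEverywhere
    where
    agreeEverywhere : ∀ m → coeff p m ≡ coeff (tabulateOn (support p) f) m
    agreeEverywhere m with m ∈? support p
    ... | yes m∈ = trans (agree m m∈) (sym (coeff-tabulateOn-∈ (support p) f (deduplicate-! _) m∈))
    ... | no  m∉ = trans (coeff-∉-support p m∉) (sym (coeff-tabulateOn-∉ (support p) f m∉))

  coeff-⊗-support : ∀ (X Y : Poly N) m →
                    coeff (X ⊗ Y) m ≡ ∑ (support Y) (λ m₂ → coeff Y m₂ ℤ.* shiftedCoeff X m₂ m)
  coeff-⊗-support X Y m = begin
    coeff (X ⊗ Y) m       ≡⟨ ≋⇒≈ (⊗-comm X Y) m ⟩
    coeff (Y ⊗ X) m       ≡⟨ ≋⇒≈ (⊗-cong (tabulateOn-support Y (coeff Y) (λ _ _ → refl)) ≋-refl) m ⟩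
    coeff (Y′ ⊗ X) m      ≡⟨ coeff-⊗′ Y′ X m ⟩
    ∑ Y′ (λ s → proj₂ s ℤ.* shiftedCoeff X (proj₁ s) m) ≡⟨ ∑-map _ (support Y) _ ⟩
    ∑ (support Y) (λ m₂ → coeff Y m₂ ℤ.* shiftedCoeff X m₂ m) ∎
    where
    open ≡-Reasoning
    Y′ : Poly N
    Y′ = tabulateOn (support Y) (coeff Y)

  ∑-δ : ∀ {S} → Unique S → ∀ {m₀} → m₀ ∈ S → ∀ v → ∑ S (λ m → δ m m₀ v) ≡ v
  ∑-δ {S} S! m₀∈S v = begin
    ∑ S (λ m → δ m _ v)               ≡⟨ sym (∑-map _ S _) ⟩
    ∑ (tabulateOn S (λ _ → v)) (termAt _) ≡⟨ sym (coeff≡∑ (tabulateOn S (λ _ → v)) _) ⟩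
    coeff (tabulateOn S (λ _ → v)) _  ≡⟨ coeff-tabulateOn-∈ S (λ _ → v) S! m₀∈S ⟩
    v                                 ∎
    where open ≡-Reasoning

  support-unique : ∀ (X : Poly N) → Unique (support X)
  support-unique X = deduplicate-! (map proj₁ X)

  ∈-support : ∀ (X : Poly N) {k m} → ¬ k ℤ∣.∣ coeff X m → m ∈ support X
  ∈-support X {k} {m} k∤ with m ∈? support X
  ... | yes m∈ = m∈
  ... | no  m∉ = ⊥-elim (k∤ (divides (+ 0) (trans (coeff-∉-support X m∉) (sym (ℤ.*-zeroˡ k)))))

-- Divisibility by integers and Gauss's lemma

infix 4 _∣ₚ_
record _∣ₚ_ {N} (k : ℤ) (X : Poly N) : Set where
  constructor dividesₚ
  field
    quotient : Poly N
    equality : X ≋ κ k ⊗ quotient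

∑-∣-difference : ∀ {A : Set} {k} (xs : List A) f g →
                 (∀ x → k ℤ∣.∣ f x ℤ.- g x) → k ℤ∣.∣ ∑ xs f ℤ.- ∑ xs g
∑-∣-difference []       f g k∣ = divides (+ 0) refl
∑-∣-difference (x ∷ xs) f g k∣ =
  subst (_ ℤ∣.∣_) (regroup (f x) (g x) (∑ xs f) (∑ xs g)) (ℤ∣.∣m∣n⇒∣m+n (k∣ x) (∑-∣-difference xs f g k∣))
  where
  regroup : ∀ a b c d → (a ℤ.- b) ℤ.+ (c ℤ.- d) ≡ (a ℤ.+ c) ℤ.- (b ℤ.+ d)
  regroup = solve-∀

prime∣*⇒∣ : ∀ {p} → Prime p → ∀ a b → + p ℤ∣.∣ a ℤ.* b → + p ℤ∣.∣ a ⊎ + p ℤ∣.∣ b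
prime∣*⇒∣ {p} p-prime a b p∣ab with euclidsLemma ℤ.∣ a ∣ ℤ.∣ b ∣ p-prime (subst (ℕ∣._∣_ p) (ℤ.abs-* a b) (ℤ∣.∣⇒∣ᵤ p∣ab))
... | inj₁ p∣a = inj₁ (ℤ∣.∣ᵤ⇒∣ p∣a)
... | inj₂ p∣b = inj₂ (ℤ∣.∣ᵤ⇒∣ p∣b)

∣-coprime-* : ∀ {m n c : ℤ} u v → u ℤ.* m ℤ.+ v ℤ.* n ≡ + 1 → m ℤ∣.∣ c → n ℤ∣.∣ c → m ℤ.* n ℤ∣.∣ c
∣-coprime-* {m} {n} {c} u v um+vn≡1 (divides y c≡ym) (divides z c≡zn) = divides (u ℤ.* z ℤ.+ v ℤ.* y) $ begin
  c                                                ≡⟨ sym (ℤ.*-identityʳ c) ⟩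
  c ℤ.* + 1                                        ≡⟨ cong (ℤ._*_ c) (sym um+vn≡1) ⟩
  c ℤ.* (u ℤ.* m ℤ.+ v ℤ.* n)                      ≡⟨ ℤ.*-distribˡ-+ c _ _ ⟩
  c ℤ.* (u ℤ.* m) ℤ.+ c ℤ.* (v ℤ.* n)              ≡⟨ cong₂ (λ x y → x ℤ.* (u ℤ.* m) ℤ.+ y ℤ.* (v ℤ.* n)) c≡zn c≡ym ⟩
  z ℤ.* n ℤ.* (u ℤ.* m) ℤ.+ y ℤ.* m ℤ.* (v ℤ.* n)  ≡⟨ regroup u v y z m n ⟩
  (u ℤ.* z ℤ.+ v ℤ.* y) ℤ.* (m ℤ.* n)              ∎
  where
  open ≡-Reasoning
  regroup : ∀ u v y z m n → z ℤ.* n ℤ.* (u ℤ.* m) ℤ.+ y ℤ.* m ℤ.* (v ℤ.* n) ≡ (u ℤ.* z ℤ.+ v ℤ.* y) ℤ.* (m ℤ.* n)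
  regroup = solve-∀

infix 4 _<ₗₑₓ_ _≤ₗₑₓ_
data _<ₗₑₓ_ : ∀ {n} → Mono n → Mono n → Set where
  this : ∀ {n x y} {a b : Mono n} → x ℕ.< y → (x ∷ a) <ₗₑₓ (y ∷ b)
  next : ∀ {n x} {a b : Mono n} → a <ₗₑₓ b → (x ∷ a) <ₗₑₓ (x ∷ b)

_≤ₗₑₓ_ : ∀ {n} → Mono n → Mono n → Set
a ≤ₗₑₓ b = a <ₗₑₓ b ⊎ a ≡ b

<ₗₑₓ-irrefl : ∀ {n} {a : Mono n} → ¬ a <ₗₑₓ a
<ₗₑₓ-irrefl (this x<x) = ℕ.<-irrefl refl x<x
<ₗₑₓ-irrefl (next a<a) = <ₗₑₓ-irrefl a<a

<ₗₑₓ-trans : ∀ {n} {a b c : Mono n} → a <ₗₑₓ b → b <ₗₑₓ c → a <ₗₑₓ c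
<ₗₑₓ-trans (this x<y) (this y<z) = this (ℕ.<-trans x<y y<z)
<ₗₑₓ-trans (this x<y) (next _)   = this x<y
<ₗₑₓ-trans (next _)   (this y<z) = this y<z
<ₗₑₓ-trans (next a<b) (next b<c) = next (<ₗₑₓ-trans a<b b<c)

<-≤ₗₑₓ-trans : ∀ {n} {a b c : Mono n} → a <ₗₑₓ b → b ≤ₗₑₓ c → a <ₗₑₓ c
<-≤ₗₑₓ-trans a<b (inj₁ b<c)  = <ₗₑₓ-trans a<b b<c
<-≤ₗₑₓ-trans a<b (inj₂ refl) = a<b

≤ₗₑₓ-trans : ∀ {n} {a b c : Mono n} → a ≤ₗₑₓ b → b ≤ₗₑₓ c → a ≤ₗₑₓ c
≤ₗₑₓ-trans (inj₁ a<b)  b≤c = inj₁ (<-≤ₗₑₓ-trans a<b b≤c)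
≤ₗₑₓ-trans (inj₂ refl) b≤c = b≤c

<ₗₑₓ-+ᵛʳ : ∀ {n} {a b : Mono n} (c : Mono n) → a <ₗₑₓ b → a +ᵛ c <ₗₑₓ b +ᵛ c
<ₗₑₓ-+ᵛʳ (z ∷ c) (this x<y) = this (ℕ.+-monoˡ-< z x<y)
<ₗₑₓ-+ᵛʳ (z ∷ c) (next a<b) = next (<ₗₑₓ-+ᵛʳ c a<b)

<ₗₑₓ-+ᵛ : ∀ {n} {a b c d : Mono n} → a <ₗₑₓ b → c ≤ₗₑₓ d → a +ᵛ c <ₗₑₓ b +ᵛ d
<ₗₑₓ-+ᵛ {c = c} a<b (inj₂ refl) = <ₗₑₓ-+ᵛʳ c a<b
<ₗₑₓ-+ᵛ {b = b} {c} {d} a<b (inj₁ c<d) = <ₗₑₓ-trans (<ₗₑₓ-+ᵛʳ c a<b)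
  (subst₂ _<ₗₑₓ_ (+ᵛ-comm c b) (+ᵛ-comm d b) (<ₗₑₓ-+ᵛʳ b c<d))

<ₗₑₓ-cmp : ∀ {n} (a b : Mono n) → a <ₗₑₓ b ⊎ a ≡ b ⊎ b <ₗₑₓ a
<ₗₑₓ-cmp []      []      = inj₂ (inj₁ refl)
<ₗₑₓ-cmp (x ∷ a) (y ∷ b) with ℕ.<-cmp x y
... | tri< x<y _ _ = inj₁ (this x<y)
... | tri> _ _ y<x = inj₂ (inj₂ (this y<x))
... | tri≈ _ refl _ with <ₗₑₓ-cmp a b
...   | inj₁ a<b        = inj₁ (next a<b)
...   | inj₂ (inj₁ refl) = inj₂ (inj₁ refl)
...   | inj₂ (inj₂ b<a) = inj₂ (inj₂ (next b<a))

module _ {N : ℕ} where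

  private
    _≟ᵛ_ : (a b : Mono N) → Dec (a ≡ b)
    _≟ᵛ_ = ≡-dec ℕ._≟_
    open DecMembership _≟ᵛ_ using (_∈?_)

  lexMaximum : ∀ {P : Mono N → Set} → (∀ m → Dec (P m)) → ∀ {m₀} → P m₀ → (S : List (Mono N)) →
               ∃ λ μ → P μ × m₀ ≤ₗₑₓ μ × (∀ {m} → m ∈ S → P m → m ≤ₗₑₓ μ)
  lexMaximum P? Pm₀ [] = _ , Pm₀ , inj₂ refl , λ ()
  lexMaximum P? {m₀} Pm₀ (m ∷ S) with P? m | <ₗₑₓ-cmp m₀ m
  ... | yes Pm | inj₁ m₀<m =
    let (μ , Pμ , m≤μ , max) = lexMaximum P? Pm S in
    μ , Pμ , inj₁ (<-≤ₗₑₓ-trans m₀<m m≤μ) , λ { (here refl) _ → m≤μ ; (there m′∈S) → max m′∈S }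
  ... | yes Pm | inj₂ m≤m₀ =
    let (μ , Pμ , m₀≤μ , max) = lexMaximum P? Pm₀ S in
    μ , Pμ , m₀≤μ , λ { (here refl) _ → ≤ₗₑₓ-trans (flip m≤m₀) m₀≤μ ; (there m′∈S) → max m′∈S }
    where
    flip : m₀ ≡ m ⊎ m <ₗₑₓ m₀ → m ≤ₗₑₓ m₀
    flip (inj₁ refl) = inj₂ refl
    flip (inj₂ m<m₀) = inj₁ m<m₀
  ... | no ¬Pm | _ =
    let (μ , Pμ , m₀≤μ , max) = lexMaximum P? Pm₀ S in
    μ , Pμ , m₀≤μ , λ { (here refl) Pm → ⊥-elim (¬Pm Pm) ; (there m′∈S) → max m′∈S }

  ∣ₚ⇒∣-coeff : ∀ {k} {X : Poly N} → k ∣ₚ X → ∀ m → k ℤ∣.∣ coeff X m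
  ∣ₚ⇒∣-coeff {k} (dividesₚ K X≋kK) m = divides (coeff K m) (trans (≋⇒≈ X≋kK m) (trans (coeff-κ⊗ k K m) (ℤ.*-comm k _)))

  -- Witnesses are opaque: unfolding them in conversion checks would evaluate
  -- the whole construction symbolically.
  opaque
    ∣-coeff⇒∣ₚ : ∀ k (X : Poly N) → (∀ m → k ℤ∣.∣ coeff X m) → k ∣ₚ X
    ∣-coeff⇒∣ₚ k X k∣ = dividesₚ K $ coeffwise λ m → trans (≋⇒≈ (tabulateOn-support X (λ m → k ℤ.* q m) (λ m _ → k∣coeff m)) m)
                                        (sym (trans (coeff-κ⊗ k K m) (coeff-scaled m)))
      where
      q : Mono N → ℤ
      q m = ℤ∣.quotient (k∣ m)
      k∣coeff : ∀ m → coeff X m ≡ k ℤ.* q m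
      k∣coeff m = trans (ℤ∣._∣_.equality (k∣ m)) (ℤ.*-comm (q m) k)
      K : Poly N
      K = tabulateOn (support X) q
      coeff-scaled : ∀ m → k ℤ.* coeff K m ≡ coeff (tabulateOn (support X) (λ m → k ℤ.* q m)) m
      coeff-scaled m with m ∈? support X
      ... | yes m∈ = trans (cong (ℤ._*_ k) (coeff-tabulateOn-∈ _ q (support-unique X) m∈))
                           (sym (coeff-tabulateOn-∈ _ _ (support-unique X) m∈))
      ... | no  m∉ = trans (cong (ℤ._*_ k) (coeff-tabulateOn-∉ _ q m∉))
                           (trans (ℤ.*-zeroʳ k) (sym (coeff-tabulateOn-∉ _ _ m∉)))

  ∣-support⇒∣ₚ : ∀ k (X : Poly N) → All (λ m → k ℤ∣.∣ coeff X m) (support X) → k ∣ₚ X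
  ∣-support⇒∣ₚ k X all∣ = ∣-coeff⇒∣ₚ k X k∣
    where
    k∣ : ∀ m → k ℤ∣.∣ coeff X m
    k∣ m with m ∈? support X
    ... | yes m∈ = All.lookup all∣ m∈
    ... | no  m∉ = divides (+ 0) (trans (coeff-∉-support X m∉) (sym (ℤ.*-zeroˡ k)))

  ∣ₚ? : ∀ k (X : Poly N) → Dec (k ∣ₚ X)
  ∣ₚ? k X with all? (λ m → k ∣? coeff X m) (support X)
  ... | yes all∣ = yes (∣-support⇒∣ₚ k X all∣)
  ... | no ¬all∣ = no λ k∣X → ¬all∣ (All.tabulate (λ {m} _ → ∣ₚ⇒∣-coeff {X = X} k∣X m))

  topNonDivisible : ∀ k (X : Poly N) → ¬ k ∣ₚ X →
                    ∃ λ μ → μ ∈ support X × ¬ k ℤ∣.∣ coeff X μ × (∀ m → μ <ₗₑₓ m → k ℤ∣.∣ coeff X m)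
  topNonDivisible k X k∤X
    with find (All.¬All⇒Any¬ (λ m → k ∣? coeff X m) (support X) (k∤X ∘ ∣-support⇒∣ₚ k X))
  ... | m₀ , m₀∈ , k∤m₀ with lexMaximum (λ m → ¬? (k ∣? coeff X m)) k∤m₀ (support X)
  ...   | μ , k∤μ , _ , max = μ , ∈-support X k∤μ , k∤μ , above
    where
    above : ∀ m → μ <ₗₑₓ m → k ℤ∣.∣ coeff X m
    above m μ<m with k ∣? coeff X m
    ... | yes k∣m = k∣m
    ... | no  k∤m = ⊥-elim (<ₗₑₓ-irrefl (<-≤ₗₑₓ-trans μ<m (max (∈-support X k∤m) k∤m)))

  coeff-⊗-top : ∀ k (X Y : Poly N) {μX μY} → μY ∈ support Y →
                (∀ m → μX <ₗₑₓ m → k ℤ∣.∣ coeff X m) → (∀ m → μY <ₗₑₓ m → k ℤ∣.∣ coeff Y m) →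
                k ℤ∣.∣ coeff (X ⊗ Y) (μX +ᵛ μY) ℤ.- coeff Y μY ℤ.* coeff X μX
  coeff-⊗-top k X Y {μX} {μY} μY∈ topX topY =
    subst₂ (λ a b → k ℤ∣.∣ a ℤ.- b) (sym (coeff-⊗-support X Y μ)) (∑-δ (support-unique Y) μY∈ v)
           (∑-∣-difference (support Y) _ _ termwise)
    where
    μ : Mono N
    μ = μX +ᵛ μY
    v : ℤ
    v = coeff Y μY ℤ.* coeff X μX
    0∣ : ∀ a {b} → a ≡ b → k ℤ∣.∣ a ℤ.- b
    0∣ a refl = divides (+ 0) (trans (ℤ.+-inverseʳ a) (sym (ℤ.*-zeroˡ k)))
    ∣-0 : ∀ {a b} → k ℤ∣.∣ a → b ≡ + 0 → k ℤ∣.∣ a ℤ.- b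
    ∣-0 {a} k∣a refl = subst (k ℤ∣.∣_) (sym (ℤ.+-identityʳ a)) k∣a
    termwise : ∀ m₂ → k ℤ∣.∣ coeff Y m₂ ℤ.* shiftedCoeff X m₂ μ ℤ.- δ m₂ μY v
    termwise m₂ with <ₗₑₓ-cmp m₂ μY
    ... | inj₂ (inj₁ refl) = 0∣ (coeff Y μY ℤ.* shiftedCoeff X μY μ)
      (trans (cong (ℤ._*_ (coeff Y μY)) (shiftedCoeff-∣ X μY μ μX (+ᵛ-comm μY μX))) (sym (δ-refl μY v)))
    ... | inj₂ (inj₂ μY<m₂) = ∣-0 (ℤ∣.∣m⇒∣m*n _ (topY m₂ μY<m₂)) (δ-≢ v (λ { refl → <ₗₑₓ-irrefl μY<m₂ }))
    ... | inj₁ m₂<μY = ∣-0 (ℤ∣.∣n⇒∣m*n (coeff Y m₂) shifted) (δ-≢ v (λ { refl → <ₗₑₓ-irrefl m₂<μY }))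
      where
      shifted : k ℤ∣.∣ shiftedCoeff X m₂ μ
      shifted with m₂ ∣ᵛ? μ
      ... | no m₂∤μ = subst (k ℤ∣.∣_) (sym (shiftedCoeff-∤ X m₂ μ m₂∤μ)) (divides (+ 0) (sym (ℤ.*-zeroˡ k)))
      ... | yes (u , m₂+u≡μ) with <ₗₑₓ-cmp u μX
      ...   | inj₂ (inj₂ μX<u) = subst (k ℤ∣.∣_) (sym (shiftedCoeff-∣ X m₂ μ u m₂+u≡μ)) (topX u μX<u)
      ...   | inj₁ u<μX = ⊥-elim (<ₗₑₓ-irrefl (subst₂ _<ₗₑₓ_ m₂+u≡μ (+ᵛ-comm μY μX) (<ₗₑₓ-+ᵛ m₂<μY (inj₁ u<μX))))
      ...   | inj₂ (inj₁ refl) = ⊥-elim (<ₗₑₓ-irrefl (subst₂ _<ₗₑₓ_ m₂+u≡μ (+ᵛ-comm μY μX) (<ₗₑₓ-+ᵛ m₂<μY (inj₂ refl))))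

  opaque
    prime∣⊗⇒∣ : ∀ {p} → Prime p → (X Y : Poly N) → + p ∣ₚ X ⊗ Y → ¬ + p ∣ₚ Y → + p ∣ₚ X
    prime∣⊗⇒∣ {p} p-prime X Y p∣XY p∤Y with ∣ₚ? (+ p) X
    ... | yes p∣X = p∣X
    ... | no  p∤X with topNonDivisible (+ p) X p∤X | topNonDivisible (+ p) Y p∤Y
    ...   | μX , _ , p∤cX , topX | μY , μY∈ , p∤cY , topY =
      ⊥-elim ([ p∤cY , p∤cX ] (prime∣*⇒∣ p-prime _ _ p∣top))
      where
      p∣top : + p ℤ∣.∣ coeff Y μY ℤ.* coeff X μX
      p∣top = subst (+ p ℤ∣.∣_) (cancel (coeff (X ⊗ Y) (μX +ᵛ μY)) _) (ℤ∣.∣m∣n⇒∣m-n (∣ₚ⇒∣-coeff {X = X ⊗ Y} p∣XY _)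
                                                           (coeff-⊗-top (+ p) X Y μY∈ topX topY))
        where
        cancel : ∀ a b → a ℤ.- (a ℤ.- b) ≡ b
        cancel = solve-∀

  κ-*-⊗ : ∀ a b (K : Poly N) → κ (a ℤ.* b) ⊗ K ≋ κ a ⊗ (κ b ⊗ K)
  κ-*-⊗ a b K = ≋-trans (⊗-cong (κ-* a b) ≋-refl) (⊗-assoc (κ a) (κ b) K)

  κ⊗-cancel : ∀ k .{{_ : ℤ.NonZero k}} (A B : Poly N) → κ k ⊗ A ≋ κ k ⊗ B → A ≋ B
  κ⊗-cancel k A B (coeffwise kA≈kB) = coeffwise λ m →
    ℤ.*-cancelˡ-≡ k (coeff A m) (coeff B m) (trans (sym (coeff-κ⊗ k A m)) (trans (kA≈kB m) (coeff-κ⊗ k B m)))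

  opaque
    prime^∣⊗⇒∣ : ∀ {p} → Prime p → ∀ j (X Y : Poly N) → (+ p) ℤ.^ j ∣ₚ X ⊗ Y → ¬ + p ∣ₚ Y → (+ p) ℤ.^ j ∣ₚ X
    prime^∣⊗⇒∣ p-prime zero    X Y _ _ = dividesₚ X (≋-sym (⊗-identityˡ X))
    prime^∣⊗⇒∣ {p} p-prime (suc j) X Y (dividesₚ K XY≋K) p∤Y with prime∣⊗⇒∣ p-prime X Y (dividesₚ (κ q ⊗ K) XY≋pqK) p∤Y
      where
      q : ℤ
      q = (+ p) ℤ.^ j
      XY≋pqK : X ⊗ Y ≋ κ (+ p) ⊗ (κ q ⊗ K)
      XY≋pqK = ≋-trans XY≋K (κ-*-⊗ (+ p) q K)
    ... | dividesₚ X′ X≋pX′ with prime^∣⊗⇒∣ p-prime j X′ Y (dividesₚ K X′Y≋qK) p∤Y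
      where
      X′Y≋qK : X′ ⊗ Y ≋ κ ((+ p) ℤ.^ j) ⊗ K
      X′Y≋qK = κ⊗-cancel (+ p) {{prime⇒nonZero p-prime}} (X′ ⊗ Y) _ (begin
        κ (+ p) ⊗ (X′ ⊗ Y)     ≈⟨ ≋-sym (⊗-assoc (κ (+ p)) X′ Y) ⟩
        κ (+ p) ⊗ X′ ⊗ Y       ≈⟨ ⊗-cong (≋-sym X≋pX′) ≋-refl ⟩
        X ⊗ Y                  ≈⟨ XY≋K ⟩
        κ ((+ p) ℤ.^ suc j) ⊗ K ≈⟨ κ-*-⊗ (+ p) _ K ⟩
        κ (+ p) ⊗ (κ ((+ p) ℤ.^ j) ⊗ K) ∎)
        where open ≋-Reasoning
    ...   | dividesₚ X″ X′≋qX″ = dividesₚ X″ (begin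
        X                           ≈⟨ X≋pX′ ⟩
        κ (+ p) ⊗ X′                ≈⟨ ⊗-congˡ (κ (+ p)) X′≋qX″ ⟩
        κ (+ p) ⊗ (κ ((+ p) ℤ.^ j) ⊗ X″) ≈⟨ ≋-sym (κ-*-⊗ (+ p) _ X″) ⟩
        κ ((+ p) ℤ.^ suc j) ⊗ X″    ∎)
      where open ≋-Reasoning

  opaque
    prime∣²⇒∣ : ∀ {p} → Prime p → (W : Poly N) → + p ∣ₚ W ⊗ W → + p ∣ₚ W
    prime∣²⇒∣ p-prime W p∣W² with ∣ₚ? _ W
    ... | yes p∣W = p∣W
    ... | no  p∤W = prime∣⊗⇒∣ p-prime W W p∣W² p∤W

  opaque
    prime∣³⇒∣ : ∀ {p} → Prime p → (W : Poly N) → + p ∣ₚ W ⊗ W ⊗ W → + p ∣ₚ W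
    prime∣³⇒∣ p-prime W p∣W³ with ∣ₚ? _ W
    ... | yes p∣W = p∣W
    ... | no  p∤W = prime∣²⇒∣ p-prime W (prime∣⊗⇒∣ p-prime (W ⊗ W) W p∣W³ p∤W)

  ¬∣ₚ-square : ∀ {p} → Prime p → {W : Poly N} → ¬ + p ∣ₚ W → ¬ + p ∣ₚ W ⊗ W
  ¬∣ₚ-square p-prime p∤W p∣W² = p∤W (prime∣²⇒∣ p-prime _ p∣W²)

  primitive⇒¬∣ₚ : ∀ {P : Poly N} → Primitive P → ∀ {d} → d ≢ 1 → ¬ + d ∣ₚ P
  primitive⇒¬∣ₚ {P} P-primitive {d} d≢1 d∣P = d≢1 (P-primitive d (λ m → ℤ∣.∣⇒∣ᵤ (∣ₚ⇒∣-coeff {X = P} d∣P m)))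

  ∣ₚ-coprime-* : ∀ {m n : ℤ} u v → u ℤ.* m ℤ.+ v ℤ.* n ≡ + 1 → {X : Poly N} → m ∣ₚ X → n ∣ₚ X → m ℤ.* n ∣ₚ X
  ∣ₚ-coprime-* u v um+vn≡1 {X} m∣X n∣X = ∣-coeff⇒∣ₚ _ X λ μ →
    ∣-coprime-* u v um+vn≡1 (∣ₚ⇒∣-coeff {X = X} m∣X μ) (∣ₚ⇒∣-coeff {X = X} n∣X μ)

prime[3] : Prime 3
prime[3] = from-yes (prime? 3)

-- Frobenius and expansions

fermat₂ : ∀ c → + 2 ℤ∣.∣ c ℤ.* c ℤ.- c
fermat₂ c = subst (λ z → + 2 ℤ∣.∣ z ℤ.* z ℤ.- z) (sym (ℤ.a≡a%ℕn+[a/ℕn]*n c 2))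
                  (byResidue (c ℤ.%ℕ 2) (c ℤ./ℕ 2) (ℤ.n%ℕd<d c 2))
  where
  byResidue : ∀ r q → r ℕ.< 2 → let c = + r ℤ.+ q ℤ.* + 2 in + 2 ℤ∣.∣ c ℤ.* c ℤ.- c
  byResidue 0 q _ = divides (+ 2 ℤ.* q ℤ.* q ℤ.- q) (identity q)
    where
    identity : ∀ q → (+ 0 ℤ.+ q ℤ.* + 2) ℤ.* (+ 0 ℤ.+ q ℤ.* + 2) ℤ.- (+ 0 ℤ.+ q ℤ.* + 2) ≡ (+ 2 ℤ.* q ℤ.* q ℤ.- q) ℤ.* + 2
    identity = solve-∀
  byResidue 1 q _ = divides (+ 2 ℤ.* q ℤ.* q ℤ.+ q) (identity q)
    where
    identity : ∀ q → (+ 1 ℤ.+ q ℤ.* + 2) ℤ.* (+ 1 ℤ.+ q ℤ.* + 2) ℤ.- (+ 1 ℤ.+ q ℤ.* + 2) ≡ (+ 2 ℤ.* q ℤ.* q ℤ.+ q) ℤ.* + 2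
    identity = solve-∀
  byResidue (suc (suc _)) q (s≤s (s≤s ()))

fermat₃ : ∀ c → + 3 ℤ∣.∣ c ℤ.* c ℤ.* c ℤ.- c
fermat₃ c = subst (λ z → + 3 ℤ∣.∣ z ℤ.* z ℤ.* z ℤ.- z) (sym (ℤ.a≡a%ℕn+[a/ℕn]*n c 3))
                  (byResidue (c ℤ.%ℕ 3) (c ℤ./ℕ 3) (ℤ.n%ℕd<d c 3))
  where
  byResidue : ∀ r q → r ℕ.< 3 → let c = + r ℤ.+ q ℤ.* + 3 in + 3 ℤ∣.∣ c ℤ.* c ℤ.* c ℤ.- c
  byResidue 0 q _ = divides (+ 9 ℤ.* q ℤ.* q ℤ.* q ℤ.- q) (identity q)
    where
    identity : ∀ q → let c = + 0 ℤ.+ q ℤ.* + 3 in c ℤ.* c ℤ.* c ℤ.- c ≡ (+ 9 ℤ.* q ℤ.* q ℤ.* q ℤ.- q) ℤ.* + 3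
    identity = solve-∀
  byResidue 1 q _ = divides (+ 9 ℤ.* q ℤ.* q ℤ.* q ℤ.+ + 9 ℤ.* q ℤ.* q ℤ.+ + 2 ℤ.* q) (identity q)
    where
    identity : ∀ q → let c = + 1 ℤ.+ q ℤ.* + 3 in
               c ℤ.* c ℤ.* c ℤ.- c ≡ (+ 9 ℤ.* q ℤ.* q ℤ.* q ℤ.+ + 9 ℤ.* q ℤ.* q ℤ.+ + 2 ℤ.* q) ℤ.* + 3
    identity = solve-∀
  byResidue 2 q _ = divides (+ 9 ℤ.* q ℤ.* q ℤ.* q ℤ.+ + 18 ℤ.* q ℤ.* q ℤ.+ + 11 ℤ.* q ℤ.+ + 2) (identity q)
    where
    identity : ∀ q → let c = + 2 ℤ.+ q ℤ.* + 3 in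
               c ℤ.* c ℤ.* c ℤ.- c ≡ (+ 9 ℤ.* q ℤ.* q ℤ.* q ℤ.+ + 18 ℤ.* q ℤ.* q ℤ.+ + 11 ℤ.* q ℤ.+ + 2) ℤ.* + 3
    identity = solve-∀
  byResidue (suc (suc (suc _))) q (s≤s (s≤s (s≤s ())))

expand : ∀ {N} → ℕ → Poly N → Poly N
expand p P = map (λ (m , c) → (Vec.map (p ℕ.*_) m , c)) P

+ᵛ-double : ∀ {n} (m : Mono n) → m +ᵛ m ≡ Vec.map (2 ℕ.*_) m
+ᵛ-double []      = refl
+ᵛ-double (x ∷ m) = cong₂ _∷_ (cong (x ℕ.+_) (sym (ℕ.+-identityʳ x))) (+ᵛ-double m)

+ᵛ-triple : ∀ {n} (m : Mono n) → m +ᵛ m +ᵛ m ≡ Vec.map (3 ℕ.*_) m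
+ᵛ-triple []      = refl
+ᵛ-triple (x ∷ m) = cong₂ _∷_ (trans (ℕ.+-assoc x x x) (cong (λ z → x ℕ.+ (x ℕ.+ z)) (sym (ℕ.+-identityʳ x))))
                              (+ᵛ-triple m)

module _ {N : ℕ} where
  open PolynomialSolver N

  term-⊖ : ∀ (m : Mono N) {a b} k q → a ℤ.- b ≡ q ℤ.* k → ((m , a) ∷ []) ⊖ ((m , b) ∷ []) ≋ κ k ⊗ ((m , q) ∷ [])
  term-⊖ m {a} {b} k q a-b≡qk = coeffwise λ m₀ → begin
    coeff ((m , a) ∷ (m , -[1+ 0 ] ℤ.* b) ∷ []) m₀    ≡⟨ trans (coeff-∷ m a _ m₀) (cong (ℤ._+_ (δ m m₀ a)) (trans (coeff-∷ m _ [] m₀) (ℤ.+-identityʳ _))) ⟩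
    δ m m₀ a ℤ.+ δ m m₀ (-[1+ 0 ] ℤ.* b)             ≡⟨ sym (δ-+ m m₀ a _) ⟩
    δ m m₀ (a ℤ.+ -[1+ 0 ] ℤ.* b)                    ≡⟨ cong (δ m m₀) (trans (cong (ℤ._+_ a) (ℤ.-1*i≡-i b)) (trans a-b≡qk (ℤ.*-comm q k))) ⟩
    δ m m₀ (k ℤ.* q)                                 ≡⟨ δ-*ˡ m m₀ k q ⟩
    k ℤ.* δ m m₀ q                                   ≡⟨ cong (ℤ._*_ k) (sym (trans (coeff-∷ m q [] m₀) (ℤ.+-identityʳ _))) ⟩
    k ℤ.* coeff ((m , q) ∷ []) m₀                    ≡⟨ sym (coeff-κ⊗ k _ m₀) ⟩
    coeff (κ k ⊗ ((m , q) ∷ [])) m₀                  ∎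
    where open ≡-Reasoning

  opaque
    frobenius₂ : ∀ (P : Poly N) → + 2 ∣ₚ P ⊗ P ⊖ expand 2 P
    frobenius₂ [] = dividesₚ [] ≋-refl
    frobenius₂ ((m , c) ∷ P) with frobenius₂ P | fermat₂ c
    ... | dividesₚ K P²≋2K | divides q c²-c≡2q = dividesₚ (K′ ⊕ K ⊕ T ⊗ P) $
      combine₂ (κ (+ 1)) (κ (+ 1)) T²≋2K′ P²≋2K
        (solve 6 (λ T P eT eP K′ K →
          (T :+ P) :* (T :+ P) :- (eT :+ eP) :- # 2 :* (K′ :+ K :+ T :* P) ⊜
          # 1 :* (T :* T :- eT :- # 2 :* K′) :+ # 1 :* (P :* P :- eP :- # 2 :* K))
          ≋-refl T P (expand 2 T) (expand 2 P) K′ K)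
      where
      T K′ : Poly N
      T  = (m , c) ∷ []
      K′ = (Vec.map (2 ℕ.*_) m , q) ∷ []
      T²≋2K′ : T ⊗ T ⊖ expand 2 T ≋ κ (+ 2) ⊗ K′
      T²≋2K′ = subst (λ v → ((v , c ℤ.* c) ∷ []) ⊖ expand 2 T ≋ κ (+ 2) ⊗ K′) (sym (+ᵛ-double m))
                     (term-⊖ (Vec.map (2 ℕ.*_) m) (+ 2) q c²-c≡2q)

  opaque
    frobenius₃ : ∀ (P : Poly N) → + 3 ∣ₚ P ⊗ P ⊗ P ⊖ expand 3 P
    frobenius₃ [] = dividesₚ [] ≋-refl
    frobenius₃ ((m , c) ∷ P) with frobenius₃ P | fermat₃ c
    ... | dividesₚ K P³≋3K | divides q c³-c≡3q = dividesₚ (K′ ⊕ K ⊕ T ⊗ T ⊗ P ⊕ T ⊗ P ⊗ P) $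
      combine₂ (κ (+ 1)) (κ (+ 1)) T³≋3K′ P³≋3K
        (solve 6 (λ T P eT eP K′ K →
          (T :+ P) :* (T :+ P) :* (T :+ P) :- (eT :+ eP) :- # 3 :* (K′ :+ K :+ T :* T :* P :+ T :* P :* P) ⊜
          # 1 :* (T :* T :* T :- eT :- # 3 :* K′) :+ # 1 :* (P :* P :* P :- eP :- # 3 :* K))
          ≋-refl T P (expand 3 T) (expand 3 P) K′ K)
      where
      T K′ : Poly N
      T  = (m , c) ∷ []
      K′ = (Vec.map (3 ℕ.*_) m , q) ∷ []
      T³≋3K′ : T ⊗ T ⊗ T ⊖ expand 3 T ≋ κ (+ 3) ⊗ K′
      T³≋3K′ = subst (λ v → ((v , c ℤ.* c ℤ.* c) ∷ []) ⊖ expand 3 T ≋ κ (+ 3) ⊗ K′) (sym (+ᵛ-triple m))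
                     (term-⊖ (Vec.map (3 ℕ.*_) m) (+ 3) q c³-c≡3q)

infix 4 _∣ᵉ_
_∣ᵉ_ : ∀ {n} → ℕ → Mono n → Set
p ∣ᵉ m = Vecᴬ.All (p ℕ∣.∣_) m

_∣ᵉ?_ : ∀ {n} p → Decidable (_∣ᵉ_ {n} p)
p ∣ᵉ? m = Vecᴬ.all? (p ℕ∣.∣?_) m

∣ᵉ-+ᵛ : ∀ {n p} {a b : Mono n} → p ∣ᵉ a → p ∣ᵉ b → p ∣ᵉ a +ᵛ b
∣ᵉ-+ᵛ Vecᴬ.[]           Vecᴬ.[]           = Vecᴬ.[]
∣ᵉ-+ᵛ (p∣x Vecᴬ.∷ p∣a) (p∣y Vecᴬ.∷ p∣b) = ℕ∣.∣m∣n⇒∣m+n p∣x p∣y Vecᴬ.∷ ∣ᵉ-+ᵛ p∣a p∣b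

∣ᵉ-+ᵛ⁻ : ∀ {n p} {a b : Mono n} → p ∣ᵉ a → p ∣ᵉ a +ᵛ b → p ∣ᵉ b
∣ᵉ-+ᵛ⁻ {a = []}    {[]}    Vecᴬ.[]           Vecᴬ.[]             = Vecᴬ.[]
∣ᵉ-+ᵛ⁻ {a = _ ∷ _} {_ ∷ _} (p∣x Vecᴬ.∷ p∣a) (p∣x+y Vecᴬ.∷ p∣a+b) = ℕ∣.∣m+n∣m⇒∣n p∣x+y p∣x Vecᴬ.∷ ∣ᵉ-+ᵛ⁻ p∣a p∣a+b

∣ᵉ-map-* : ∀ {n} p (m : Mono n) → p ∣ᵉ Vec.map (p ℕ.*_) m
∣ᵉ-map-* p []      = Vecᴬ.[]
∣ᵉ-map-* p (x ∷ m) = ℕ∣.m∣m*n x Vecᴬ.∷ ∣ᵉ-map-* p m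

map-*-/ : ∀ {n} p .{{_ : ℕ.NonZero p}} {m : Mono n} → p ∣ᵉ m → Vec.map (p ℕ.*_) (Vec.map (ℕ._/ p) m) ≡ m
map-*-/ p Vecᴬ.[]           = refl
map-*-/ p (p∣x Vecᴬ.∷ p∣m) = cong₂ _∷_ (ℕ.m*[n/m]≡n p∣x) (map-*-/ p p∣m)

map-*-injective : ∀ {n} p .{{_ : ℕ.NonZero p}} (a b : Mono n) → Vec.map (p ℕ.*_) a ≡ Vec.map (p ℕ.*_) b → a ≡ b
map-*-injective p []      []      _  = refl
map-*-injective p (x ∷ a) (y ∷ b) eq =
  cong₂ _∷_ (ℕ.*-cancelˡ-≡ x y p (cong Vec.head eq)) (map-*-injective p a b (cong Vec.tail eq))

∑-filter : ∀ {A : Set} {P : A → Set} (P? : Decidable P) xs f →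
           ∑ xs f ≡ ∑ (filter P? xs) f ℤ.+ ∑ (filter (¬? ∘ P?) xs) f
∑-filter P? []       f = refl
∑-filter P? (x ∷ xs) f with P? x
... | yes _ = trans (cong (ℤ._+_ (f x)) (∑-filter P? xs f)) (sym (ℤ.+-assoc (f x) _ _))
... | no  _ = trans (cong (ℤ._+_ (f x)) (∑-filter P? xs f)) (swap (f x) (∑ (filter P? xs) f) _)
  where
  swap : ∀ a b c → a ℤ.+ (b ℤ.+ c) ≡ b ℤ.+ (a ℤ.+ c)
  swap = solve-∀

module _ {N : ℕ} where

  ≋-partition : ∀ {P : Mono N × ℤ → Set} (P? : Decidable P) (B : Poly N) → B ≋ filter P? B ⊕ filter (¬? ∘ P?) B
  ≋-partition P? B = coeffwise λ m → trans (coeff≡∑ B m) (trans (∑-filter P? B (termAt m))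
    (sym (trans (coeff-⊕ (filter P? B) _ m) (cong₂ ℤ._+_ (coeff≡∑ (filter P? B) m) (coeff≡∑ (filter (¬? ∘ P?) B) m)))))

  coeff-All-¬ : ∀ {P : Mono N → Set} (X : Poly N) → All (P ∘ proj₁) X → ∀ {m} → ¬ P m → coeff X m ≡ + 0
  coeff-All-¬ []             []          ¬Pm = refl
  coeff-All-¬ ((m′ , c) ∷ X) (Pm′ ∷ PX) {m} ¬Pm =
    trans (coeff-∷ m′ c X m) (cong₂ ℤ._+_ (δ-≢ {m′ = m′} {m} c λ { refl → ¬Pm Pm′ }) (coeff-All-¬ X PX ¬Pm))

  All-⊗ : ∀ {P Q R : Mono N → Set} (X Y : Poly N) → All (P ∘ proj₁) X → All (Q ∘ proj₁) Y →
          (∀ {a b} → P a → Q b → R (a +ᵛ b)) → All (R ∘ proj₁) (X ⊗ Y)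
  All-⊗ []      Y []        QY PQ⇒R = []
  All-⊗ (s ∷ X) Y (Ps ∷ PX) QY PQ⇒R = All.++⁺ (All.map⁺ (All.map (PQ⇒R Ps) QY)) (All-⊗ X Y PX QY PQ⇒R)

  All-expand : ∀ p (A : Poly N) → All ((p ∣ᵉ_) ∘ proj₁) (expand p A)
  All-expand p A = All.map⁺ (All.universal (λ t → ∣ᵉ-map-* p (proj₁ t)) A)

  module _ (p : ℕ) .{{_ : ℕ.NonZero p}} where

    contract : Poly N → Poly N
    contract G = map (λ (m , c) → (Vec.map (ℕ._/ p) m , c)) G

    expand-contract : ∀ (G : Poly N) → All ((p ∣ᵉ_) ∘ proj₁) G → expand p (contract G) ≡ G
    expand-contract []      []          = refl
    expand-contract (t ∷ G) (p∣t ∷ p∣G) = cong₂ _∷_ (cong (_, proj₂ t) (map-*-/ p p∣t)) (expand-contract G p∣G)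

    coeff-expand : ∀ (A : Poly N) m → coeff (expand p A) (Vec.map (p ℕ.*_) m) ≡ coeff A m
    coeff-expand A m = trans (coeff≡∑ (expand p A) _) (trans (∑-map _ A _) (trans
      (∑-cong A (λ t → δ-cong (proj₂ t) (map-*-injective p _ _) (cong (Vec.map (p ℕ.*_)))))
      (sym (coeff≡∑ A m))))

    ∣ₚ-expand⇒∣ₚ : ∀ (A : Poly N) → + p ∣ₚ expand p A → + p ∣ₚ A
    ∣ₚ-expand⇒∣ₚ A p∣A′ = ∣-coeff⇒∣ₚ (+ p) A λ m →
      subst (+ p ℤ∣.∣_) (coeff-expand A m) (∣ₚ⇒∣-coeff {X = expand p A} p∣A′ (Vec.map (p ℕ.*_) m))

module _ {N : ℕ} where

  onLattice? : ∀ p → Decidable (λ (t : Mono N × ℤ) → p ∣ᵉ proj₁ t)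
  onLattice? p t = p ∣ᵉ? proj₁ t

  onLattice offLattice : ℕ → Poly N → Poly N
  onLattice  p = filter (onLattice? p)
  offLattice p = filter (¬? ∘ onLattice? p)

  -- Off the lattice pℕᴺ, the coefficients of A(xᵖ) B come only from the terms of B
  -- off the lattice, and C(xᵖ) has none.
  ∣ₚ-offLattice : ∀ p (A B C : Poly N) → + p ∣ₚ expand p A ⊗ B ⊖ expand p C → + p ∣ₚ offLattice p B ⊗ expand p A
  ∣ₚ-offLattice p A B C p∣A′B-C′ = ∣-coeff⇒∣ₚ (+ p) (B′ ⊗ A′) λ m →
    subst (+ p ℤ∣.∣_) (≋⇒≈ (⊗-comm A′ B′) m) (p∣A′B′ m)
    where
    A′ B′ G : Poly N
    A′ = expand p A
    B′ = offLattice p B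
    G  = onLattice p B
    p∣A′B′ : ∀ m → + p ℤ∣.∣ coeff (A′ ⊗ B′) m
    p∣A′B′ m with p ∣ᵉ? m
    ... | yes p∣m = divides (+ 0) (coeff-All-¬ (A′ ⊗ B′) A′B′-exponents (λ p∤m → p∤m p∣m))
      where
      A′B′-exponents : All ((λ m → ¬ p ∣ᵉ m) ∘ proj₁) (A′ ⊗ B′)
      A′B′-exponents = All-⊗ A′ B′ (All-expand p A) (All.all-filter (¬? ∘ onLattice? p) B) (λ p∣a p∤b p∣a+b → p∤b (∣ᵉ-+ᵛ⁻ p∣a p∣a+b))
    ... | no  p∤m = subst (+ p ℤ∣.∣_) only-A′B′ (∣ₚ⇒∣-coeff {X = A′ ⊗ B ⊖ expand p C} p∣A′B-C′ m)
      where
      A′G-exponents : All ((p ∣ᵉ_) ∘ proj₁) (A′ ⊗ G)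
      A′G-exponents = All-⊗ A′ G (All-expand p A) (All.all-filter (onLattice? p) B) ∣ᵉ-+ᵛ
      A′B≋A′G+A′B′ : A′ ⊗ B ≋ A′ ⊗ G ⊕ A′ ⊗ B′
      A′B≋A′G+A′B′ = ≋-trans (⊗-congˡ A′ (≋-partition (onLattice? p) B)) (⊗-distribˡ-⊕ A′ G B′)
      only-A′B′ : coeff (A′ ⊗ B ⊖ expand p C) m ≡ coeff (A′ ⊗ B′) m
      only-A′B′ = begin
        coeff (A′ ⊗ B ⊖ expand p C) m                          ≡⟨ coeff-⊕ (A′ ⊗ B) _ m ⟩
        coeff (A′ ⊗ B) m ℤ.+ coeff (⊝ expand p C) m             ≡⟨ cong₂ ℤ._+_ (≋⇒≈ A′B≋A′G+A′B′ m) (coeff-⊝ (expand p C) m) ⟩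
        coeff (A′ ⊗ G ⊕ A′ ⊗ B′) m ℤ.+ ℤ.- coeff (expand p C) m ≡⟨ cong₂ ℤ._+_ (coeff-⊕ (A′ ⊗ G) _ m)
                                                                       (cong ℤ.-_ (coeff-All-¬ (expand p C) (All-expand p C) p∤m)) ⟩
        coeff (A′ ⊗ G) m ℤ.+ coeff (A′ ⊗ B′) m ℤ.+ + 0           ≡⟨ ℤ.+-identityʳ _ ⟩
        coeff (A′ ⊗ G) m ℤ.+ coeff (A′ ⊗ B′) m                   ≡⟨ cong (ℤ._+ coeff (A′ ⊗ B′) m) (coeff-All-¬ (A′ ⊗ G) A′G-exponents p∤m) ⟩
        + 0 ℤ.+ coeff (A′ ⊗ B′) m                                ≡⟨ ℤ.+-identityˡ _ ⟩
        coeff (A′ ⊗ B′) m                                        ∎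
        where open ≡-Reasoning

  open PolynomialSolver N

  -- The off-lattice part of B is divisible by p by Gauss's lemma, and the rest of B is an expansion.
  opaque
    expanded-mod-prime : ∀ {p} → Prime p → (A B C : Poly N) → ¬ + p ∣ₚ A → + p ∣ₚ expand p A ⊗ B ⊖ expand p C →
                         ∃ λ s → + p ∣ₚ B ⊖ expand p s
    expanded-mod-prime {p} p-prime A B C p∤A p∣A′B-C′ = contract p G , dividesₚ K B-G′≋pK
      where
      instance
        p≢0 : ℕ.NonZero p
        p≢0 = prime⇒nonZero p-prime
      G B′ K : Poly N
      G  = onLattice p B
      B′ = offLattice p B
      p∣B′ : + p ∣ₚ B′
      p∣B′ = prime∣⊗⇒∣ p-prime B′ (expand p A) (∣ₚ-offLattice p A B C p∣A′B-C′) (p∤A ∘ ∣ₚ-expand⇒∣ₚ p A)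
      K = _∣ₚ_.quotient p∣B′
      B-G≋pK : B ⊖ G ≋ κ (+ p) ⊗ K
      B-G≋pK = ≋-trans (combine₁ (κ (+ 1)) (≋-partition (onLattice? p) B)
                         (solve 3 (λ B G B′ → B :- G :- B′ ⊜ # 1 :* (B :- (G :+ B′))) ≋-refl B G B′))
                       (_∣ₚ_.equality p∣B′)
      B-G′≋pK : B ⊖ expand p (contract p G) ≋ κ (+ p) ⊗ K
      B-G′≋pK = subst (λ G′ → B ⊖ G′ ≋ κ (+ p) ⊗ K) (sym (expand-contract p G (All.all-filter (onLattice? p) B))) B-G≋pK

module _ {N : ℕ} where
  open PolynomialSolver N

  module _ {a c₄ c₆ : Poly N} (a²c₄+c₆≡0 : + 4 ∣ₚ a ⊗ a ⊗ c₄ ⊕ c₆) (2∤c₆ : ¬ + 2 ∣ₚ c₆) where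

    private
      e : Poly N
      e = _∣ₚ_.quotient a²c₄+c₆≡0
      a²c₄+c₆≋4e : a ⊗ a ⊗ c₄ ⊕ c₆ ≋ κ (+ 4) ⊗ e
      a²c₄+c₆≋4e = _∣ₚ_.equality a²c₄+c₆≡0

    2∤a : ¬ + 2 ∣ₚ a
    2∤a (dividesₚ K a≋2K) = 2∤c₆ $ dividesₚ (κ (+ 2) ⊗ e ⊖ κ (+ 2) ⊗ K ⊗ K ⊗ c₄) $
      combine₂ (κ (+ 1)) (⊝ ((a ⊕ κ (+ 2) ⊗ K) ⊗ c₄)) a²c₄+c₆≋4e a≋2K
        (solve 5 (λ a c₄ c₆ e K →
          c₆ :- # 2 :* (# 2 :* e :- # 2 :* K :* K :* c₄) ⊜
          # 1 :* (a :* a :* c₄ :+ c₆ :- # 4 :* e) :+ (:- ((a :+ # 2 :* K) :* c₄)) :* (a :- # 2 :* K))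
          ≋-refl a c₄ c₆ e K)

    2∤c₄ : ¬ + 2 ∣ₚ c₄
    2∤c₄ (dividesₚ K c₄≋2K) = 2∤c₆ $ dividesₚ (κ (+ 2) ⊗ e ⊖ a ⊗ a ⊗ K) $
      combine₂ (κ (+ 1)) (⊝ (a ⊗ a)) a²c₄+c₆≋4e c₄≋2K
        (solve 5 (λ a c₄ c₆ e K →
          c₆ :- # 2 :* (# 2 :* e :- a :* a :* K) ⊜
          # 1 :* (a :* a :* c₄ :+ c₆ :- # 4 :* e) :+ (:- (a :* a)) :* (c₄ :- # 2 :* K))
          ≋-refl a c₄ c₆ e K)

    opaque
      8∣c₄-a⁴ : ∀ {Δ} → c₄ ⊗ c₄ ⊗ c₄ ⊖ c₆ ⊗ c₆ ≋ κ (+ 1728) ⊗ Δ → + 8 ∣ₚ c₄ ⊖ a ⊗ a ⊗ a ⊗ a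
      8∣c₄-a⁴ {Δ} disc = prime^∣⊗⇒∣ prime[2] 3 (c₄ ⊖ a ⊗ a ⊗ a ⊗ a) (c₄ ⊗ c₄)
        (dividesₚ (κ (+ 216) ⊗ Δ ⊕ κ (+ 2) ⊗ e ⊗ e ⊖ e ⊗ a ⊗ a ⊗ c₄) $
          combine₂ (κ (+ 1)) (c₆ ⊕ κ (+ 4) ⊗ e ⊖ a ⊗ a ⊗ c₄) disc a²c₄+c₆≋4e
            (solve 5 (λ a c₄ c₆ Δ e →
              (c₄ :- a :* a :* a :* a) :* (c₄ :* c₄) :- # 8 :* (# 216 :* Δ :+ # 2 :* e :* e :- e :* a :* a :* c₄) ⊜
              # 1 :* (c₄ :* c₄ :* c₄ :- c₆ :* c₆ :- # 1728 :* Δ) :+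
              (c₆ :+ # 4 :* e :- a :* a :* c₄) :* (a :* a :* c₄ :+ c₆ :- # 4 :* e))
              ≋-refl a c₄ c₆ Δ e))
        (¬∣ₚ-square prime[2] 2∤c₄)

  module _ {c₄ c₆ Δ : Poly N} (disc : c₄ ⊗ c₄ ⊗ c₄ ⊖ c₆ ⊗ c₆ ≋ κ (+ 1728) ⊗ Δ) (3∤c₆ : ¬ + 3 ∣ₚ c₆) where

    3∤c₄ : ¬ + 3 ∣ₚ c₄
    3∤c₄ (dividesₚ K c₄≋3K) = 3∤c₆ $ prime∣²⇒∣ prime[3] c₆ $ dividesₚ (κ (+ 9) ⊗ K ⊗ K ⊗ K ⊖ κ (+ 576) ⊗ Δ) $
      combine₂ (κ -[1+ 0 ]) (c₄ ⊗ c₄ ⊕ κ (+ 3) ⊗ K ⊗ c₄ ⊕ κ (+ 9) ⊗ K ⊗ K) disc c₄≋3K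
        (solve 4 (λ c₄ c₆ Δ K →
          c₆ :* c₆ :- # 3 :* (# 9 :* K :* K :* K :- # 576 :* Δ) ⊜
          Κ -[1+ 0 ] :* (c₄ :* c₄ :* c₄ :- c₆ :* c₆ :- # 1728 :* Δ) :+
          (c₄ :* c₄ :+ # 3 :* K :* c₄ :+ # 9 :* K :* K) :* (c₄ :- # 3 :* K))
          ≋-refl c₄ c₆ Δ K)

    -- c₄′ c₆ ≡ c₄³ c₆ ≡ c₆³ ≡ c₆′ (mod 3), primes denoting expand 3
    3∣c₄′c₆-c₆′ : + 3 ∣ₚ expand 3 c₄ ⊗ c₆ ⊖ expand 3 c₆
    3∣c₄′c₆-c₆′ = dividesₚ (κ (+ 576) ⊗ c₆ ⊗ Δ ⊖ F₄ ⊗ c₆ ⊕ F₆) $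
      combine₃ c₆ (⊝ c₆) (κ (+ 1)) disc (_∣ₚ_.equality (frobenius₃ c₄)) (_∣ₚ_.equality (frobenius₃ c₆))
        (solve 7 (λ c₄ c₆ Δ c₄′ c₆′ F₄ F₆ →
          c₄′ :* c₆ :- c₆′ :- # 3 :* (# 576 :* c₆ :* Δ :- F₄ :* c₆ :+ F₆) ⊜
          c₆ :* (c₄ :* c₄ :* c₄ :- c₆ :* c₆ :- # 1728 :* Δ) :+ (:- c₆) :* (c₄ :* c₄ :* c₄ :- c₄′ :- # 3 :* F₄) :+
          # 1 :* (c₆ :* c₆ :* c₆ :- c₆′ :- # 3 :* F₆))
          ≋-refl c₄ c₆ Δ (expand 3 c₄) (expand 3 c₆) F₄ F₆)
      where
      F₄ F₆ : Poly N
      F₄ = _∣ₚ_.quotient (frobenius₃ c₄)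
      F₆ = _∣ₚ_.quotient (frobenius₃ c₆)

    opaque
      cube-root-mod-3 : ∃ λ s → + 3 ∣ₚ c₆ ⊖ s ⊗ s ⊗ s × + 3 ∣ₚ c₄ ⊖ s ⊗ s
      cube-root-mod-3 = s , dividesₚ v c₆≋s³+3v , prime∣³⇒∣ prime[3] (c₄ ⊖ s ⊗ s) (dividesₚ W c₄-s²-cubed)
        where
        c₆≡s′ : ∃ λ s → + 3 ∣ₚ c₆ ⊖ expand 3 s
        c₆≡s′ = expanded-mod-prime prime[3] c₄ c₆ c₆ 3∤c₄ 3∣c₄′c₆-c₆′
        s V Fₛ v W : Poly N
        s = proj₁ c₆≡s′
        V = _∣ₚ_.quotient (proj₂ c₆≡s′)
        Fₛ = _∣ₚ_.quotient (frobenius₃ s)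
        v = V ⊖ Fₛ
        c₆≋s³+3v : c₆ ⊖ s ⊗ s ⊗ s ≋ κ (+ 3) ⊗ v
        c₆≋s³+3v = combine₂ (κ (+ 1)) (κ -[1+ 0 ]) (_∣ₚ_.equality (proj₂ c₆≡s′)) (_∣ₚ_.equality (frobenius₃ s))
          (solve 5 (λ c₆ s s′ V Fₛ →
            c₆ :- s :* s :* s :- # 3 :* (V :- Fₛ) ⊜
            # 1 :* (c₆ :- s′ :- # 3 :* V) :+ Κ -[1+ 0 ] :* (s :* s :* s :- s′ :- # 3 :* Fₛ))
            ≋-refl c₆ s (expand 3 s) V Fₛ)
        W = ⊝ (c₄ ⊗ c₄ ⊗ s ⊗ s) ⊕ c₄ ⊗ s ⊗ s ⊗ s ⊗ s ⊕ κ (+ 2) ⊗ s ⊗ s ⊗ s ⊗ v ⊕ κ (+ 3) ⊗ v ⊗ v ⊕ κ (+ 576) ⊗ Δ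
        c₄-s²-cubed : (c₄ ⊖ s ⊗ s) ⊗ (c₄ ⊖ s ⊗ s) ⊗ (c₄ ⊖ s ⊗ s) ≋ κ (+ 3) ⊗ W
        c₄-s²-cubed = combine₂ (κ (+ 1)) (c₆ ⊕ s ⊗ s ⊗ s ⊕ κ (+ 3) ⊗ v) disc c₆≋s³+3v
          (solve 5 (λ c₄ c₆ Δ s v →
            (c₄ :- s :* s) :* (c₄ :- s :* s) :* (c₄ :- s :* s) :-
            # 3 :* (:- (c₄ :* c₄ :* s :* s) :+ c₄ :* s :* s :* s :* s :+ # 2 :* s :* s :* s :* v :+ # 3 :* v :* v :+ # 576 :* Δ) ⊜
            # 1 :* (c₄ :* c₄ :* c₄ :- c₆ :* c₆ :- # 1728 :* Δ) :+ (c₆ :+ s :* s :* s :+ # 3 :* v) :* (c₆ :- s :* s :* s :- # 3 :* v))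
            ≋-refl c₄ c₆ Δ s v)

module _ {N : ℕ} where
  open PolynomialSolver N

  module _ (a s : Poly N) where

    a₂ b₂ : Poly N
    a₂ = ⊝ s ⊖ a ⊗ a
    b₂ = a ⊗ a ⊕ κ (+ 4) ⊗ a₂

    4∣b₂-a² : + 4 ∣ₚ b₂ ⊖ a ⊗ a
    4∣b₂-a² = dividesₚ a₂ (solve 2 (λ a a₂ → a :* a :+ # 4 :* a₂ :- a :* a ⊜ # 4 :* a₂) ≋-refl a a₂)

    2∤b₂ : ¬ + 2 ∣ₚ a → ¬ + 2 ∣ₚ b₂
    2∤b₂ 2∤a (dividesₚ K b₂≋2K) = 2∤a $ prime∣²⇒∣ prime[2] a $ dividesₚ (K ⊖ κ (+ 2) ⊗ a₂) $
      combine₁ (κ (+ 1)) b₂≋2K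
        (solve 3 (λ a a₂ K → a :* a :- # 2 :* (K :- # 2 :* a₂) ⊜ # 1 :* (a :* a :+ # 4 :* a₂ :- # 2 :* K)) ≋-refl a a₂ K)

    module _ {c₄ h₈ u : Poly N} (c₄≋a⁴+8h₈ : c₄ ⊖ a ⊗ a ⊗ a ⊗ a ≋ κ (+ 8) ⊗ h₈)
                                (c₄≋s²+3u : c₄ ⊖ s ⊗ s ≋ κ (+ 3) ⊗ u) where

      opaque
        24∣b₂²-c₄ : + 24 ∣ₚ b₂ ⊗ b₂ ⊖ c₄
        24∣b₂²-c₄ = ∣ₚ-coprime-* -[1+ 0 ] (+ 3) refl 8∣ 3∣
          where
          8∣ : + 8 ∣ₚ b₂ ⊗ b₂ ⊖ c₄
          8∣ = dividesₚ (a ⊗ a ⊗ a₂ ⊕ κ (+ 2) ⊗ a₂ ⊗ a₂ ⊖ h₈) $ combine₁ (κ -[1+ 0 ]) c₄≋a⁴+8h₈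
            (solve 4 (λ a c₄ a₂ h₈ →
              (a :* a :+ # 4 :* a₂) :* (a :* a :+ # 4 :* a₂) :- c₄ :- # 8 :* (a :* a :* a₂ :+ # 2 :* a₂ :* a₂ :- h₈) ⊜
              Κ -[1+ 0 ] :* (c₄ :- a :* a :* a :* a :- # 8 :* h₈))
              ≋-refl a c₄ a₂ h₈)
          3∣ : + 3 ∣ₚ b₂ ⊗ b₂ ⊖ c₄
          3∣ = dividesₚ (κ (+ 5) ⊗ s ⊗ s ⊕ κ (+ 8) ⊗ s ⊗ a ⊗ a ⊕ κ (+ 3) ⊗ a ⊗ a ⊗ a ⊗ a ⊖ u) $ combine₁ (κ -[1+ 0 ]) c₄≋s²+3u
            (solve 4 (λ a c₄ s u →
              (a :* a :+ # 4 :* (:- s :- a :* a)) :* (a :* a :+ # 4 :* (:- s :- a :* a)) :- c₄ :-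
              # 3 :* (# 5 :* s :* s :+ # 8 :* s :* a :* a :+ # 3 :* a :* a :* a :* a :- u) ⊜
              Κ -[1+ 0 ] :* (c₄ :- s :* s :- # 3 :* u))
              ≋-refl a c₄ s u)

    module _ {c₄ c₆ Δ e h₈ v b₄ : Poly N}
             (disc : c₄ ⊗ c₄ ⊗ c₄ ⊖ c₆ ⊗ c₆ ≋ κ (+ 1728) ⊗ Δ) (2∤c₆ : ¬ + 2 ∣ₚ c₆) (3∤c₆ : ¬ + 3 ∣ₚ c₆)
             (a²c₄+c₆≋4e : a ⊗ a ⊗ c₄ ⊕ c₆ ≋ κ (+ 4) ⊗ e) (c₄≋a⁴+8h₈ : c₄ ⊖ a ⊗ a ⊗ a ⊗ a ≋ κ (+ 8) ⊗ h₈)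
             (c₆≋s³+3v : c₆ ⊖ s ⊗ s ⊗ s ≋ κ (+ 3) ⊗ v) (b₂²≋c₄+24b₄ : b₂ ⊗ b₂ ⊖ c₄ ≋ κ (+ 24) ⊗ b₄) where

      -- b₆ is defined by h = 216 b₆, which is the required formula for c₆
      h : Poly N
      h = ⊝ (b₂ ⊗ b₂ ⊗ b₂) ⊕ κ (+ 36) ⊗ (b₂ ⊗ b₄) ⊖ c₆

      private
        M X : Poly N
        M = b₄ ⊗ b₄ ⊗ (κ (+ 32) ⊗ b₄ ⊖ b₂ ⊗ b₂) ⊕ κ (+ 4) ⊗ Δ
        X = b₂ ⊗ b₂ ⊖ κ (+ 24) ⊗ b₄

      h[h+2c₆]≋432M : h ⊗ (h ⊕ κ (+ 2) ⊗ c₆) ≋ κ (+ 432) ⊗ M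
      h[h+2c₆]≋432M = combine₂ (κ (+ 1)) (X ⊗ X ⊕ X ⊗ c₄ ⊕ c₄ ⊗ c₄) disc b₂²≋c₄+24b₄
        (solve 5 (λ c₄ c₆ Δ b₂ b₄ →
          let h = :- (b₂ :* b₂ :* b₂) :+ # 36 :* (b₂ :* b₄) :- c₆
              X = b₂ :* b₂ :- # 24 :* b₄ in
          h :* (h :+ # 2 :* c₆) :- # 432 :* (b₄ :* b₄ :* (# 32 :* b₄ :- b₂ :* b₂) :+ # 4 :* Δ) ⊜
          # 1 :* (c₄ :* c₄ :* c₄ :- c₆ :* c₆ :- # 1728 :* Δ) :+ (X :* X :+ X :* c₄ :+ c₄ :* c₄) :* (b₂ :* b₂ :- c₄ :- # 24 :* b₄))
          ≋-refl c₄ c₆ Δ b₂ b₄)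

      F₁ : Poly N
      F₁ = ⊝ (κ (+ 3) ⊗ a ⊗ a ⊗ a ⊗ a ⊗ a₂) ⊖ κ (+ 12) ⊗ a ⊗ a ⊗ a₂ ⊗ a₂ ⊖ κ (+ 16) ⊗ a₂ ⊗ a₂ ⊗ a₂
           ⊕ κ (+ 9) ⊗ b₂ ⊗ b₄ ⊖ e ⊕ κ (+ 2) ⊗ a ⊗ a ⊗ h₈

      h≋4F₁ : h ≋ κ (+ 4) ⊗ F₁
      h≋4F₁ = combine₂ (κ -[1+ 0 ]) (a ⊗ a) a²c₄+c₆≋4e c₄≋a⁴+8h₈
        (solve 7 (λ a a₂ c₄ c₆ e h₈ b₄ →
          let b₂ = a :* a :+ # 4 :* a₂ in
          :- (b₂ :* b₂ :* b₂) :+ # 36 :* (b₂ :* b₄) :- c₆ :-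
          # 4 :* (:- (# 3 :* a :* a :* a :* a :* a₂) :- # 12 :* a :* a :* a₂ :* a₂ :- # 16 :* a₂ :* a₂ :* a₂
                  :+ # 9 :* b₂ :* b₄ :- e :+ # 2 :* a :* a :* h₈) ⊜
          Κ -[1+ 0 ] :* (a :* a :* c₄ :+ c₆ :- # 4 :* e) :+ a :* a :* (c₄ :- a :* a :* a :* a :- # 8 :* h₈))
          ≋-refl a a₂ c₄ c₆ e h₈ b₄)

      H₃ : Poly N
      H₃ = κ (+ 9) ⊗ a ⊗ a ⊗ a ⊗ a ⊗ a ⊗ a ⊕ κ (+ 36) ⊗ a ⊗ a ⊗ a ⊗ a ⊗ s ⊕ κ (+ 48) ⊗ a ⊗ a ⊗ s ⊗ s
           ⊕ κ (+ 21) ⊗ s ⊗ s ⊗ s ⊕ κ (+ 12) ⊗ b₂ ⊗ b₄ ⊖ v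

      h≋3H₃ : h ≋ κ (+ 3) ⊗ H₃
      h≋3H₃ = combine₁ (κ -[1+ 0 ]) c₆≋s³+3v
        (solve 5 (λ a s c₆ v b₄ →
          let b₂ = a :* a :+ # 4 :* (:- s :- a :* a) in
          :- (b₂ :* b₂ :* b₂) :+ # 36 :* (b₂ :* b₄) :- c₆ :-
          # 3 :* (# 9 :* a :* a :* a :* a :* a :* a :+ # 36 :* a :* a :* a :* a :* s :+ # 48 :* a :* a :* s :* s
                  :+ # 21 :* s :* s :* s :+ # 12 :* b₂ :* b₄ :- v) ⊜
          Κ -[1+ 0 ] :* (c₆ :- s :* s :* s :- # 3 :* v))
          ≋-refl a s c₆ v b₄)

      27∣h : + 27 ∣ₚ h
      27∣h = prime^∣⊗⇒∣ prime[3] 3 h (h ⊕ κ (+ 2) ⊗ c₆)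
        (dividesₚ (κ (+ 16) ⊗ M) (≋-trans h[h+2c₆]≋432M (κ-*-⊗ (+ 27) (+ 16) M))) 3∤h+2c₆
        where
        3∤h+2c₆ : ¬ + 3 ∣ₚ h ⊕ κ (+ 2) ⊗ c₆
        3∤h+2c₆ (dividesₚ G h+2c₆≋3G) = 3∤c₆ $ dividesₚ (c₆ ⊖ G ⊕ H₃) $
          combine₂ (κ -[1+ 0 ]) (κ (+ 1)) h+2c₆≋3G h≋3H₃
            (solve 4 (λ h c₆ G H₃ →
              c₆ :- # 3 :* (c₆ :- G :+ H₃) ⊜
              Κ -[1+ 0 ] :* (h :+ # 2 :* c₆ :- # 3 :* G) :+ # 1 :* (h :- # 3 :* H₃))
              ≋-refl h c₆ G H₃)

      8∣h : + 8 ∣ₚ h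
      8∣h = dividesₚ F₂ $ combine₂ (κ (+ 1)) (κ (+ 4)) h≋4F₁ F₁≋2F₂
        (solve 3 (λ h F₁ F₂ → h :- # 8 :* F₂ ⊜ # 1 :* (h :- # 4 :* F₁) :+ # 4 :* (F₁ :- # 2 :* F₂)) ≋-refl h F₁ F₂)
        where
        F₁[2F₁+c₆]≋54M : F₁ ⊗ (κ (+ 2) ⊗ F₁ ⊕ c₆) ≋ κ (+ 2) ⊗ (κ (+ 27) ⊗ M)
        F₁[2F₁+c₆]≋54M = κ⊗-cancel (+ 8) _ _ $ combine₂ (κ (+ 1)) (⊝ (h ⊕ κ (+ 4) ⊗ F₁ ⊕ κ (+ 2) ⊗ c₆)) h[h+2c₆]≋432M h≋4F₁
          (solve 4 (λ h c₆ M F₁ →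
            # 8 :* (F₁ :* (# 2 :* F₁ :+ c₆)) :- # 8 :* (# 2 :* (# 27 :* M)) ⊜
            # 1 :* (h :* (h :+ # 2 :* c₆) :- # 432 :* M) :+ (:- (h :+ # 4 :* F₁ :+ # 2 :* c₆)) :* (h :- # 4 :* F₁))
            ≋-refl h c₆ M F₁)
        2∤2F₁+c₆ : ¬ + 2 ∣ₚ κ (+ 2) ⊗ F₁ ⊕ c₆
        2∤2F₁+c₆ (dividesₚ G 2F₁+c₆≋2G) = 2∤c₆ $ dividesₚ (G ⊖ F₁) $ combine₁ (κ (+ 1)) 2F₁+c₆≋2G
          (solve 3 (λ c₆ F₁ G → c₆ :- # 2 :* (G :- F₁) ⊜ # 1 :* (# 2 :* F₁ :+ c₆ :- # 2 :* G)) ≋-refl c₆ F₁ G)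
        2∣F₁ : + 2 ∣ₚ F₁
        2∣F₁ = prime∣⊗⇒∣ prime[2] F₁ (κ (+ 2) ⊗ F₁ ⊕ c₆) (dividesₚ (κ (+ 27) ⊗ M) F₁[2F₁+c₆]≋54M) 2∤2F₁+c₆
        F₂ : Poly N
        F₂ = _∣ₚ_.quotient 2∣F₁
        F₁≋2F₂ : F₁ ≋ κ (+ 2) ⊗ F₂
        F₁≋2F₂ = _∣ₚ_.equality 2∣F₁

      opaque
        216∣h : + 216 ∣ₚ h
        216∣h = ∣ₚ-coprime-* -[1+ 9 ] (+ 3) refl 8∣h 27∣h

module _ {N : ℕ} where
  open PolynomialSolver N

  module _ {b₂ b₄ b₆ c₄ c₆ Δ : Poly N} (disc : c₄ ⊗ c₄ ⊗ c₄ ⊖ c₆ ⊗ c₆ ≋ κ (+ 1728) ⊗ Δ)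
           (c₄≋ : c₄ ≋ b₂ ⊗ b₂ ⊖ κ (+ 24) ⊗ b₄)
           (c₆≋ : c₆ ≋ ⊝ (b₂ ⊗ b₂ ⊗ b₂) ⊕ κ (+ 36) ⊗ (b₂ ⊗ b₄) ⊖ κ (+ 216) ⊗ b₆) where

    4Δ≋ : κ (+ 4) ⊗ Δ ≋ b₂ ⊗ b₂ ⊗ b₄ ⊗ b₄ ⊖ b₂ ⊗ b₂ ⊗ b₂ ⊗ b₆ ⊖ κ (+ 32) ⊗ b₄ ⊗ b₄ ⊗ b₄ ⊖ κ (+ 108) ⊗ b₆ ⊗ b₆
                        ⊕ κ (+ 36) ⊗ b₂ ⊗ b₄ ⊗ b₆
    4Δ≋ = κ⊗-cancel (+ 432) _ _ $
      combine₃ (κ -[1+ 0 ]) (c₄ ⊗ c₄ ⊕ c₄ ⊗ X ⊕ X ⊗ X) (⊝ (c₆ ⊕ Y)) disc c₄≋ c₆≋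
        (solve 6 (λ b₂ b₄ b₆ c₄ c₆ Δ →
          let X = b₂ :* b₂ :- # 24 :* b₄
              Y = :- (b₂ :* b₂ :* b₂) :+ # 36 :* (b₂ :* b₄) :- # 216 :* b₆ in
          # 432 :* (# 4 :* Δ) :-
          # 432 :* (b₂ :* b₂ :* b₄ :* b₄ :- b₂ :* b₂ :* b₂ :* b₆ :- # 32 :* b₄ :* b₄ :* b₄ :- # 108 :* b₆ :* b₆
                    :+ # 36 :* b₂ :* b₄ :* b₆) ⊜
          Κ -[1+ 0 ] :* (c₄ :* c₄ :* c₄ :- c₆ :* c₆ :- # 1728 :* Δ) :+ (c₄ :* c₄ :+ c₄ :* X :+ X :* X) :* (c₄ :- X)
          :+ (:- (c₆ :+ Y)) :* (c₆ :- Y))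
          ≋-refl b₂ b₄ b₆ c₄ c₆ Δ)
      where
      X Y : Poly N
      X = b₂ ⊗ b₂ ⊖ κ (+ 24) ⊗ b₄
      Y = ⊝ (b₂ ⊗ b₂ ⊗ b₂) ⊕ κ (+ 36) ⊗ (b₂ ⊗ b₄) ⊖ κ (+ 216) ⊗ b₆

    4∣b₄²-b₂b₆ : ¬ + 2 ∣ₚ b₂ → + 4 ∣ₚ b₄ ⊗ b₄ ⊖ b₂ ⊗ b₆
    4∣b₄²-b₂b₆ 2∤b₂ = prime^∣⊗⇒∣ prime[2] 2 (b₄ ⊗ b₄ ⊖ b₂ ⊗ b₆) (b₂ ⊗ b₂)
      (dividesₚ (Δ ⊕ κ (+ 8) ⊗ b₄ ⊗ b₄ ⊗ b₄ ⊕ κ (+ 27) ⊗ b₆ ⊗ b₆ ⊖ κ (+ 9) ⊗ b₂ ⊗ b₄ ⊗ b₆) $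
        combine₁ (κ -[1+ 0 ]) 4Δ≋
          (solve 4 (λ b₂ b₄ b₆ Δ →
            (b₄ :* b₄ :- b₂ :* b₆) :* (b₂ :* b₂) :-
            # 4 :* (Δ :+ # 8 :* b₄ :* b₄ :* b₄ :+ # 27 :* b₆ :* b₆ :- # 9 :* b₂ :* b₄ :* b₆) ⊜
            Κ -[1+ 0 ] :* (# 4 :* Δ :- (b₂ :* b₂ :* b₄ :* b₄ :- b₂ :* b₂ :* b₂ :* b₆ :- # 32 :* b₄ :* b₄ :* b₄
                                         :- # 108 :* b₆ :* b₆ :+ # 36 :* b₂ :* b₄ :* b₆)))
            ≋-refl b₂ b₄ b₆ Δ))
      (¬∣ₚ-square prime[2] 2∤b₂)

  module _ {a b₄ b₆ : Poly N} (2∤a : ¬ + 2 ∣ₚ a) (4∣b₄²-a²b₆ : + 4 ∣ₚ b₄ ⊗ b₄ ⊖ a ⊗ a ⊗ b₆) where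

    private
      M : Poly N
      M = _∣ₚ_.quotient 4∣b₄²-a²b₆
      b₄²≋a²b₆+4M : b₄ ⊗ b₄ ⊖ a ⊗ a ⊗ b₆ ≋ κ (+ 4) ⊗ M
      b₄²≋a²b₆+4M = _∣ₚ_.equality 4∣b₄²-a²b₆

    -- a′ b₆ ≡ a² b₆ ≡ b₄² ≡ b₄′ (mod 2), primes denoting expand 2
    2∣a′b₆-b₄′ : + 2 ∣ₚ expand 2 a ⊗ b₆ ⊖ expand 2 b₄
    2∣a′b₆-b₄′ = dividesₚ (⊝ (κ (+ 2) ⊗ M) ⊖ Fₐ ⊗ b₆ ⊕ F₄) $
      combine₃ (κ -[1+ 0 ]) (⊝ b₆) (κ (+ 1)) b₄²≋a²b₆+4M (_∣ₚ_.equality (frobenius₂ a)) (_∣ₚ_.equality (frobenius₂ b₄))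
        (solve 8 (λ a b₄ b₆ a′ b₄′ M Fₐ F₄ →
          a′ :* b₆ :- b₄′ :- # 2 :* (:- (# 2 :* M) :- Fₐ :* b₆ :+ F₄) ⊜
          Κ -[1+ 0 ] :* (b₄ :* b₄ :- a :* a :* b₆ :- # 4 :* M) :+ (:- b₆) :* (a :* a :- a′ :- # 2 :* Fₐ)
          :+ # 1 :* (b₄ :* b₄ :- b₄′ :- # 2 :* F₄))
          ≋-refl a b₄ b₆ (expand 2 a) (expand 2 b₄) M Fₐ F₄)
      where
      Fₐ F₄ : Poly N
      Fₐ = _∣ₚ_.quotient (frobenius₂ a)
      F₄ = _∣ₚ_.quotient (frobenius₂ b₄)

    module _ {a₃ : Poly N} (b₆≡a₃′ : + 2 ∣ₚ b₆ ⊖ expand 2 a₃) where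

      -- (b₄ − a a₃)² ≡ b₄² − a² a₃² ≡ a² (b₆ − a₃²) ≡ 0 (mod 2)
      2∣b₄-aa₃ : + 2 ∣ₚ b₄ ⊖ a ⊗ a₃
      2∣b₄-aa₃ = prime∣²⇒∣ prime[2] (b₄ ⊖ a ⊗ a₃) $
        dividesₚ (κ (+ 2) ⊗ M ⊕ a ⊗ a ⊗ (V ⊖ F₃) ⊕ a ⊗ a ⊗ a₃ ⊗ a₃ ⊖ a ⊗ a₃ ⊗ b₄) $
          combine₃ (κ (+ 1)) (a ⊗ a) (⊝ (a ⊗ a)) b₄²≋a²b₆+4M (_∣ₚ_.equality b₆≡a₃′) (_∣ₚ_.equality (frobenius₂ a₃))
            (solve 8 (λ a b₄ b₆ a₃ a₃′ M V F₃ →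
              (b₄ :- a :* a₃) :* (b₄ :- a :* a₃) :-
              # 2 :* (# 2 :* M :+ a :* a :* (V :- F₃) :+ a :* a :* a₃ :* a₃ :- a :* a₃ :* b₄) ⊜
              # 1 :* (b₄ :* b₄ :- a :* a :* b₆ :- # 4 :* M) :+ a :* a :* (b₆ :- a₃′ :- # 2 :* V)
              :+ (:- (a :* a)) :* (a₃ :* a₃ :- a₃′ :- # 2 :* F₃))
              ≋-refl a b₄ b₆ a₃ (expand 2 a₃) M V F₃)
        where
        V F₃ : Poly N
        V  = _∣ₚ_.quotient b₆≡a₃′
        F₃ = _∣ₚ_.quotient (frobenius₂ a₃)

      4∣b₆-a₃² : + 4 ∣ₚ b₆ ⊖ a₃ ⊗ a₃
      4∣b₆-a₃² = prime^∣⊗⇒∣ prime[2] 2 (b₆ ⊖ a₃ ⊗ a₃) (a ⊗ a)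
        (dividesₚ (a ⊗ a₃ ⊗ a₄ ⊕ a₄ ⊗ a₄ ⊖ M) $
          combine₂ (b₄ ⊕ a ⊗ a₃ ⊕ κ (+ 2) ⊗ a₄) (κ -[1+ 0 ]) (_∣ₚ_.equality 2∣b₄-aa₃) b₄²≋a²b₆+4M
            (solve 6 (λ a b₄ b₆ a₃ a₄ M →
              (b₆ :- a₃ :* a₃) :* (a :* a) :- # 4 :* (a :* a₃ :* a₄ :+ a₄ :* a₄ :- M) ⊜
              (b₄ :+ a :* a₃ :+ # 2 :* a₄) :* (b₄ :- a :* a₃ :- # 2 :* a₄) :+
              Κ -[1+ 0 ] :* (b₄ :* b₄ :- a :* a :* b₆ :- # 4 :* M))
              ≋-refl a b₄ b₆ a₃ a₄ M))
        (¬∣ₚ-square prime[2] 2∤a)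
        where
        a₄ : Poly N
        a₄ = _∣ₚ_.quotient 2∣b₄-aa₃

  4∣b₄²-a²b₆ : ∀ {a b₂ b₄ b₆ : Poly N} → + 4 ∣ₚ b₂ ⊖ a ⊗ a → + 4 ∣ₚ b₄ ⊗ b₄ ⊖ b₂ ⊗ b₆ → + 4 ∣ₚ b₄ ⊗ b₄ ⊖ a ⊗ a ⊗ b₆
  4∣b₄²-a²b₆ {a} {b₂} {b₄} {b₆} (dividesₚ T b₂≋a²+4T) (dividesₚ M b₄²≋b₂b₆+4M) =
    dividesₚ (M ⊕ T ⊗ b₆) $ combine₂ (κ (+ 1)) b₆ b₄²≋b₂b₆+4M b₂≋a²+4T
      (solve 6 (λ a b₂ b₄ b₆ M T →
        b₄ :* b₄ :- a :* a :* b₆ :- # 4 :* (M :+ T :* b₆) ⊜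
        # 1 :* (b₄ :* b₄ :- b₂ :* b₆ :- # 4 :* M) :+ b₆ :* (b₂ :- a :* a :- # 4 :* T))
        ≋-refl a b₂ b₄ b₆ M T)

  a₃a₄a₆ : ∀ {a b₂ b₄ b₆ : Poly N} → ¬ + 2 ∣ₚ a → + 4 ∣ₚ b₂ ⊖ a ⊗ a → + 4 ∣ₚ b₄ ⊗ b₄ ⊖ b₂ ⊗ b₆ →
           Σ (Poly N) λ a₃ → Σ (Poly N) λ a₄ → Σ (Poly N) λ a₆ →
             b₄ ≋ a ⊗ a₃ ⊕ κ (+ 2) ⊗ a₄ × b₆ ≋ a₃ ⊗ a₃ ⊕ κ (+ 4) ⊗ a₆
  a₃a₄a₆ {a} {b₂} {b₄} {b₆} 2∤a 4∣b₂-a² 4∣b₄²-b₂b₆ =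
    a₃ , a₄ , a₆ , ⊖≋⇒≋⊕ (_∣ₚ_.equality 2∣b₄-aa₃′) , ⊖≋⇒≋⊕ (_∣ₚ_.equality 4∣b₆-a₃²′)
    where
    4∣b₄²-a²b₆′ : + 4 ∣ₚ b₄ ⊗ b₄ ⊖ a ⊗ a ⊗ b₆
    4∣b₄²-a²b₆′ = 4∣b₄²-a²b₆ {a = a} {b₂} {b₄} {b₆} 4∣b₂-a² 4∣b₄²-b₂b₆
    b₆≡a₃′ : ∃ λ a₃ → + 2 ∣ₚ b₆ ⊖ expand 2 a₃
    b₆≡a₃′ = expanded-mod-prime prime[2] a b₆ b₄ 2∤a (2∣a′b₆-b₄′ {a = a} {b₄} {b₆} 2∤a 4∣b₄²-a²b₆′)
    a₃ : Poly N
    a₃ = proj₁ b₆≡a₃′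
    2∣b₄-aa₃′ : + 2 ∣ₚ b₄ ⊖ a ⊗ a₃
    2∣b₄-aa₃′ = 2∣b₄-aa₃ {a = a} {b₄} {b₆} 2∤a 4∣b₄²-a²b₆′ {a₃} (proj₂ b₆≡a₃′)
    4∣b₆-a₃²′ : + 4 ∣ₚ b₆ ⊖ a₃ ⊗ a₃
    4∣b₆-a₃²′ = 4∣b₆-a₃² {a = a} {b₄} {b₆} 2∤a 4∣b₄²-a²b₆′ {a₃} (proj₂ b₆≡a₃′)
    a₄ a₆ : Poly N
    a₄ = _∣ₚ_.quotient 2∣b₄-aa₃′
    a₆ = _∣ₚ_.quotient 4∣b₆-a₃²′

module _ {N : ℕ} where

  kraus : ∀ {c₄ c₆ Δ a₁ : Poly N} → c₄ ⊗ c₄ ⊗ c₄ ⊖ c₆ ⊗ c₆ ≋ κ (+ 1728) ⊗ Δ → ¬ + 2 ∣ₚ c₆ → ¬ + 3 ∣ₚ c₆ →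
          + 4 ∣ₚ a₁ ⊗ a₁ ⊗ c₄ ⊕ c₆ →
          Σ (Poly N) λ a₂ → Σ (Poly N) λ a₃ → Σ (Poly N) λ a₄ → Σ (Poly N) λ a₆ → Σ (Poly N) λ b₄ → Σ (Poly N) λ b₆ →
            let b₂ = a₁ ⊗ a₁ ⊕ κ (+ 4) ⊗ a₂ in
            b₄ ≋ a₁ ⊗ a₃ ⊕ κ (+ 2) ⊗ a₄ × b₆ ≋ a₃ ⊗ a₃ ⊕ κ (+ 4) ⊗ a₆ ×
            c₄ ≋ b₂ ⊗ b₂ ⊖ κ (+ 24) ⊗ b₄ × c₆ ≋ ⊝ (b₂ ⊗ b₂ ⊗ b₂) ⊕ κ (+ 36) ⊗ (b₂ ⊗ b₄) ⊖ κ (+ 216) ⊗ b₆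
  kraus {c₄} {c₆} {Δ} {a₁} disc 2∤c₆ 3∤c₆ 4∣a₁²c₄+c₆ =
    case a₃a₄a₆ 2∤a₁ (4∣b₂-a² a₁ s) (4∣b₄²-b₂b₆ {b₂ = b₂ a₁ s} {b₄} {b₆} {c₄} {c₆} {Δ} disc c₄≋ c₆≋ (2∤b₂ a₁ s 2∤a₁)) of λ where
      (a₃ , a₄ , a₆ , b₄≋ , b₆≋) → a₂ a₁ s , a₃ , a₄ , a₆ , b₄ , b₆ , b₄≋ , b₆≋ , c₄≋ , c₆≋
    where
    s : Poly N
    s = proj₁ (cube-root-mod-3 disc 3∤c₆)
    3∣c₆-s³ : + 3 ∣ₚ c₆ ⊖ s ⊗ s ⊗ s
    3∣c₆-s³ = proj₁ (proj₂ (cube-root-mod-3 disc 3∤c₆))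
    3∣c₄-s² : + 3 ∣ₚ c₄ ⊖ s ⊗ s
    3∣c₄-s² = proj₂ (proj₂ (cube-root-mod-3 disc 3∤c₆))
    8∣c₄-a₁⁴ : + 8 ∣ₚ c₄ ⊖ a₁ ⊗ a₁ ⊗ a₁ ⊗ a₁
    8∣c₄-a₁⁴ = 8∣c₄-a⁴ {a = a₁} {c₄ = c₄} {c₆ = c₆} 4∣a₁²c₄+c₆ 2∤c₆ {Δ} disc
    2∤a₁ : ¬ + 2 ∣ₚ a₁
    2∤a₁ = 2∤a {a = a₁} {c₄ = c₄} {c₆ = c₆} 4∣a₁²c₄+c₆ 2∤c₆
    24∣ : + 24 ∣ₚ b₂ a₁ s ⊗ b₂ a₁ s ⊖ c₄
    24∣ = 24∣b₂²-c₄ a₁ s (_∣ₚ_.equality 8∣c₄-a₁⁴) (_∣ₚ_.equality 3∣c₄-s²)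
    b₄ : Poly N
    b₄ = _∣ₚ_.quotient 24∣
    216∣ : + 216 ∣ₚ ⊝ (b₂ a₁ s ⊗ b₂ a₁ s ⊗ b₂ a₁ s) ⊕ κ (+ 36) ⊗ (b₂ a₁ s ⊗ b₄) ⊖ c₆
    216∣ = 216∣h a₁ s disc 2∤c₆ 3∤c₆ (_∣ₚ_.equality 4∣a₁²c₄+c₆) (_∣ₚ_.equality 8∣c₄-a₁⁴)
                 (_∣ₚ_.equality 3∣c₆-s³) (_∣ₚ_.equality 24∣)
    b₆ : Poly N
    b₆ = _∣ₚ_.quotient 216∣
    c₄≋ : c₄ ≋ b₂ a₁ s ⊗ b₂ a₁ s ⊖ κ (+ 24) ⊗ b₄
    c₄≋ = ⊖≋⇒≋⊖ (_∣ₚ_.equality 24∣)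
    c₆≋ : c₆ ≋ ⊝ (b₂ a₁ s ⊗ b₂ a₁ s ⊗ b₂ a₁ s) ⊕ κ (+ 36) ⊗ (b₂ a₁ s ⊗ b₄) ⊖ κ (+ 216) ⊗ b₆
    c₆≋ = ⊖≋⇒≋⊖ (_∣ₚ_.equality 216∣)

≡𝟘[mod]⇒∣ₚ : ∀ {N} {k} {X : Poly N} → X ≡ 𝟘 [mod k ] → k ∣ₚ X
≡𝟘[mod]⇒∣ₚ {k = k} {X} X≡0 = ∣-coeff⇒∣ₚ k X λ m → ℤ∣.∣ᵤ⇒∣ (subst (ℤᵘ._∣_ k) (ℤ.+-identityʳ (coeff X m)) (X≡0 m))

⊕κ⊗≋⊕· : ∀ {N} (p : Poly N) k q → p ⊕ κ k ⊗ q ≋ p ⊕ k · q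
⊕κ⊗≋⊕· p k q = ⊕-cong ≋-refl (≋-sym (·≋κ⊗ k q))

⊖κ⊗≋⊖· : ∀ {N} (p : Poly N) k q → p ⊖ κ k ⊗ q ≋ p ⊖ k · q
⊖κ⊗≋⊖· p k q = ⊕-cong ≋-refl (⊝-cong (≋-sym (·≋κ⊗ k q)))

lemma1p2 : (N : ℕ) (c₄ c₆ Δ : Poly N) → Primitive c₄ → Primitive c₆ → Primitive Δ
    → (c₄ ⊗ c₄ ⊗ c₄) ⊖ (c₆ ⊗ c₆) ≈ (+ 1728) · Δ
    → (a₁ : Poly N) → (a₁ ⊗ a₁ ⊗ c₄) ⊕ c₆ ≡ 𝟘 [mod (+ 4) ]
    → Σ (Poly N) λ a₂ → Σ (Poly N) λ a₃ → Σ (Poly N) λ a₄ → Σ (Poly N) λ a₆ →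
      Σ (Poly N) λ b₂ → Σ (Poly N) λ b₄ → Σ (Poly N) λ b₆ →
        (b₂ ≈ (a₁ ⊗ a₁) ⊕ ((+ 4) · a₂))
        × (b₄ ≈ (a₁ ⊗ a₃) ⊕ ((+ 2) · a₄))
        × (b₆ ≈ (a₃ ⊗ a₃) ⊕ ((+ 4) · a₆))
        × (c₄ ≈ (b₂ ⊗ b₂) ⊖ ((+ 24) · b₄))
        × (c₆ ≈ ((⊝ (b₂ ⊗ b₂ ⊗ b₂)) ⊕ ((+ 36) · (b₂ ⊗ b₄))) ⊖ ((+ 216) · b₆))
-- only the primitivity of c₆ is needed
lemma1p2 N c₄ c₆ Δ _ c₆-primitive _ disc a₁ a₁²c₄+c₆≡0 =
  case kraus {c₄ = c₄} {c₆} {Δ} {a₁} disc′ 2∤c₆ 3∤c₆ (≡𝟘[mod]⇒∣ₚ a₁²c₄+c₆≡0) of λ where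
    (a₂ , a₃ , a₄ , a₆ , b₄ , b₆ , b₄≋ , b₆≋ , c₄≋ , c₆≋) →
      let b₂ = a₁ ⊗ a₁ ⊕ κ (+ 4) ⊗ a₂ in
      a₂ , a₃ , a₄ , a₆ , b₂ , b₄ , b₆ ,
      ≋⇒≈ (⊕κ⊗≋⊕· (a₁ ⊗ a₁) (+ 4) a₂) ,
      ≋⇒≈ (≋-trans b₄≋ (⊕κ⊗≋⊕· (a₁ ⊗ a₃) (+ 2) a₄)) ,
      ≋⇒≈ (≋-trans b₆≋ (⊕κ⊗≋⊕· (a₃ ⊗ a₃) (+ 4) a₆)) ,
      ≋⇒≈ (≋-trans c₄≋ (⊖κ⊗≋⊖· _ (+ 24) b₄)) ,
      ≋⇒≈ (≋-trans c₆≋ (≋-trans (⊖κ⊗≋⊖· _ (+ 216) b₆)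
                                 (⊕-cong (⊕κ⊗≋⊕· (⊝ (b₂ ⊗ b₂ ⊗ b₂)) (+ 36) (b₂ ⊗ b₄)) (≋-refl {p = ⊝ ((+ 216) · b₆)}))))
  where
  disc′ : c₄ ⊗ c₄ ⊗ c₄ ⊖ c₆ ⊗ c₆ ≋ κ (+ 1728) ⊗ Δ
  disc′ = ≋-trans (coeffwise disc) (·≋κ⊗ (+ 1728) Δ)
  2∤c₆ : ¬ + 2 ∣ₚ c₆
  2∤c₆ = primitive⇒¬∣ₚ c₆-primitive λ ()
  3∤c₆ : ¬ + 3 ∣ₚ c₆
  3∤c₆ = primitive⇒¬∣ₚ c₆-primitive λ ()
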